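{- Let $X_1,\dots,X_k$ be weighted graphs on $n_1,\dots,n_k$ vertices respectively, and suppose that for each $j$ there is an invertible $n_j\times n_j$ matrix $S_j$ with $S_j^{ -1}L(X_j)S_j$ diagonal, whose first column is the all-ones vector $\mathbf{1}_{n_j}$ and all of whose other columns are orthogonal to $\mathbf{1}_{n_j}$. Let $X=\bigsqcup_{j=1}^k X_j$, with vertices ordered so that those of $X_1$ come first, then those of $X_2$, and so on, and let $N=\sum_j n_j$. For $j=1,\dots,k-1$ let $\mathbf{v}_j\in\mathbb{R}^N$ be the vector equal to $1$ on the vertices of $X_j$, $-1$ on the vertices of $X_{j+1}$, and $0$ elsewhere. Then $L(X)$ is diagonalized by the $N\times N$ matrix $$\Big[\ \mathbf{1}_N\ \ \mathbf{v}_1\ \cdots\ \mathbf{v}_{k-1}\ \Big|\ \bigoplus_{j=1}^k S_j[1]\ \Big],$$ i.e. this matrix is invertible and conjugates $L(X)$ to a diagonal matrix. In particular, if in addition each $S_j$ is a weak Hadamard matrix (so each $X_j$ is WHD) and either $k=2$ or $n_1=\cdots=n_k$, then $X$ is WHD.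
   Context: Graphs are finite, simple, undirected and edge-weighted; $L(X)=D(X)-A(X)$ is the Laplacian (weighted degree matrix minus weighted adjacency matrix). For a matrix $M$, $M[j]$ denotes $M$ with its $j$-th column deleted; $\bigoplus$ denotes block-diagonal direct sum. $\bigsqcup$ denotes disjoint union of graphs. A weak Hadamard matrix is a real square matrix $P$ with entries in $\{ -1,0,1\}$ such that $P^TP$ is tridiagonal; a graph is weakly Hadamard diagonalizable (WHD) if its Laplacian is $P^{ -1}$-conjugated to a diagonal matrix by some invertible weak Hadamard matrix $P$. -}

module Defs where

open import Level using (Level; _⊔_)
open import Algebra.Bundles using (CommutativeRing)
open import Data.Nat as ℕ using (ℕ; zero; suc)
open import Data.Fin as Fin using (Fin; zero; suc; splitAt; toℕ; inject₁)
open import Data.Fin.Properties using (_≟_)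
open import Data.Vec as Vec using (Vec; []; _∷_; lookup)
open import Data.Product using (Σ; _×_; _,_; ∃)
open import Data.Sum using (_⊎_; inj₁; inj₂)
open import Relation.Nullary using (¬_; yes; no)
open import Relation.Binary.PropositionalEquality using (_≡_; refl)

-- Linear algebra over a commutative ring R (stand-in for ℝ).
module LinAlg {c ℓ : Level} (R : CommutativeRing c ℓ) where
  open CommutativeRing R public hiding (zero)

  Matrix : ℕ → ℕ → Set c
  Matrix m n = Fin m → Fin n → Carrier

  sumF : ∀ {n} → (Fin n → Carrier) → Carrier
  sumF {zero}  f = 0#
  sumF {suc n} f = f zero + sumF (λ i → f (suc i))

  natR : ℕ → Carrier
  natR zero    = 0#
  natR (suc m) = 1# + natR m

  _⊗_ : ∀ {m n p} → Matrix m n → Matrix n p → Matrix m p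
  (A ⊗ B) i j = sumF (λ l → A i l * B l j)

  transpose : ∀ {m n} → Matrix m n → Matrix n m
  transpose A i j = A j i

  idM : ∀ {n} → Matrix n n
  idM i j with i ≟ j
  ... | yes _ = 1#
  ... | no  _ = 0#

  _≈M_ : ∀ {m n} → Matrix m n → Matrix m n → Set ℓ
  A ≈M B = ∀ i j → A i j ≈ B i j

  IsInverse : ∀ {m n} → Matrix n m → Matrix m n → Set ℓ
  IsInverse T S = ((T ⊗ S) ≈M idM) × ((S ⊗ T) ≈M idM)

  IsDiagonal : ∀ {n} → Matrix n n → Set ℓ
  IsDiagonal D = ∀ i j → ¬ (i ≡ j) → D i j ≈ 0#

  Diagonalizes : ∀ {m n} → Matrix m n → Matrix m m → Set (c ⊔ ℓ)
  Diagonalizes {m} {n} S L =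
    Σ (Matrix n m) λ T → IsInverse T S × IsDiagonal ((T ⊗ L) ⊗ S)

  -- weighted simple graph on n vertices given by its weight matrix
  -- (weight 0 = no edge): symmetric, no loops
  IsWeightedGraph : ∀ {n} → Matrix n n → Set ℓ
  IsWeightedGraph w = (∀ i j → w i j ≈ w j i) × (∀ i → w i i ≈ 0#)

  laplacian : ∀ {n} → Matrix n n → Matrix n n
  laplacian w i j with i ≟ j
  ... | yes _ = sumF (λ l → w i l)
  ... | no  _ = - (w i j)

  IsWeakHadamard : ∀ {n} → Matrix n n → Set ℓ
  IsWeakHadamard P =
    (∀ i j → (P i j ≈ - 1#) ⊎ (P i j ≈ 0#) ⊎ (P i j ≈ 1#)) ×
    (∀ i j → (suc (toℕ i) ℕ.< toℕ j) ⊎ (suc (toℕ j) ℕ.< toℕ i) →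
             (transpose P ⊗ P) i j ≈ 0#)

  WHD : ∀ {n} → Matrix n n → Set (c ⊔ ℓ)
  WHD {n} w = Σ (Matrix n n) λ P → IsWeakHadamard P × Diagonalizes P (laplacian w)

  -- Disjoint union of k+1 graphs X_0,…,X_k of sizes suc (ms j).
  module Union {k : ℕ} (ms : Vec ℕ (suc k)) where

    size : Fin (suc k) → ℕ
    size j = suc (lookup ms j)

    totalV : ∀ {k'} → Vec ℕ k' → ℕ
    totalV []       = 0
    totalV (m ∷ ms') = suc m ℕ.+ totalV ms'

    N : ℕ
    N = totalV ms

    -- vertex i of X lies in block j, as vertex x of X_j (blocks in order)
    vtxV : ∀ {k'} (ms' : Vec ℕ k') → Fin (totalV ms') →
           Σ (Fin k') (λ j → Fin (suc (lookup ms' j)))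
    vtxV (m ∷ ms') i with splitAt (suc m) i
    ... | inj₁ a = zero , a
    ... | inj₂ b with vtxV ms' b
    ...   | j , x = suc j , x

    vtx : Fin N → Σ (Fin (suc k)) (λ j → Fin (size j))
    vtx = vtxV ms

    -- number of columns of ⊕ S_j[1]
    restV : ∀ {k'} → Vec ℕ k' → ℕ
    restV []        = 0
    restV (m ∷ ms') = m ℕ.+ restV ms'

    -- column b of ⊕ S_j[1] is column (suc c) of S_j
    rcolV : ∀ {k'} (ms' : Vec ℕ k') → Fin (restV ms') →
            Σ (Fin k') (λ j → Fin (lookup ms' j))
    rcolV (m ∷ ms') b with splitAt m b
    ... | inj₁ a = zero , a
    ... | inj₂ b' with rcolV ms' b'
    ...   | j , x = suc j , x

    M : ℕ
    M = suc k ℕ.+ restV ms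

    crossW : (ws : (j : Fin (suc k)) → Matrix (size j) (size j)) →
             (j j' : Fin (suc k)) → Fin (size j) → Fin (size j') → Carrier
    crossW ws j j' x x' with j ≟ j'
    ... | yes refl = ws j x x'
    ... | no  _    = 0#

    unionW : ((j : Fin (suc k)) → Matrix (size j) (size j)) → Matrix N N
    unionW ws i i' with vtx i | vtx i'
    ... | j , x | j' , x' = crossW ws j j' x x'

    -- entry of ⊕_j S_j[1] at row (vertex x of block j') and column c of block j
    blockEntry : (Ss : (j : Fin (suc k)) → Matrix (size j) (size j)) →
                 (j' j : Fin (suc k)) → Fin (size j') → Fin (lookup ms j) → Carrier
    blockEntry Ss j' j x c with j' ≟ j
    ... | yes refl = Ss j x (suc c)
    ... | no  _    = 0#

    -- v_t (t = 0,…,k-1): 1 on block t, -1 on block t+1, 0 elsewhere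
    vEntry : Fin k → Fin (suc k) → Carrier
    vEntry t j with j ≟ inject₁ t | j ≟ suc t
    ... | yes _ | _     = 1#
    ... | no  _ | yes _ = - 1#
    ... | no  _ | no  _ = 0#

    -- the matrix [ 1_N v_1 … v_{k-1} | ⊕ S_j[1] ]  (N × M, and M = N)
    bigMatrix : ((j : Fin (suc k)) → Matrix (size j) (size j)) → Matrix N M
    bigMatrix Ss i col with vtx i | splitAt (suc k) col
    ... | j' , x | inj₁ zero    = 1#
    ... | j' , x | inj₁ (suc t) = vEntry t j'
    ... | j' , x | inj₂ b with rcolV ms b
    ...   | j , c = blockEntry Ss j' j x c

{-# OPTIONS --safe #-}
-- The big matrix B factors as (⊕ S_j) times a matrix that is the identity on the columns
-- S_j[1] and, on the first columns of the S_j, equals the (k+1)×(k+1) matrix C of 1 and the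
-- differences e_s − e_{s+1}.  C has the explicit inverse G whose first row is constantly
-- 1/(k+1) (this is where every positive integer must be invertible) and whose row s+1 is the
-- indicator of {0,…,s} minus (s+1)/(k+1); the two products reduce to counting and to a
-- telescoping sum.  This gives B⁻¹ explicitly.  Every column of B is an eigenvector of L(X):
-- the columns 1, v_1, …, v_k are constant on each component, hence in the kernel, and the
-- others are eigenvectors of some L(X_j) extended by zero.
--
-- For the weak Hadamard part, B has entries in {−1,0,1}, and in BᵀB the columns of different
-- S_j have disjoint support, the columns of S_j[1] are orthogonal to everything constant on
-- blocks, v_s ⊥ v_s′ when |s − s′| ≥ 2, and 1 · v_s = n_s − n_{s+1} vanishes when all sizes
-- agree; when k = 1 the pair (1, v_1) is adjacent, so nothing is required.
module Submission where

open import Defs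
open import Level using (Level)
open import Algebra.Bundles using (CommutativeRing)
open import Data.Nat as ℕ using (ℕ; zero; suc; z≤n; s≤s; _<?_)
open import Data.Nat.Properties as ℕ using () renaming (_≟_ to _≟ℕ_)
open import Data.Fin using (Fin; zero; suc; toℕ; inject₁; _↑ˡ_; _↑ʳ_; splitAt)
open import Data.Fin.Properties
  using ( _≟_; suc-injective; toℕ<n; toℕ-injective; toℕ-inject₁; toℕ-↑ˡ; toℕ-↑ʳ; ↑ˡ-injective
        ; splitAt-↑ˡ; splitAt-↑ʳ; splitAt⁻¹-↑ˡ; splitAt⁻¹-↑ʳ)
open import Data.Vec using (Vec; []; _∷_; lookup)
open import Data.Product using (Σ; _×_; _,_; proj₁; proj₂)
open import Data.Sum using (_⊎_; inj₁; inj₂)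
open import Data.Empty using (⊥-elim)
open import Function using (_∘_)
open import Relation.Nullary using (¬_; Dec; yes; no)
open import Relation.Binary.Definitions using (tri<; tri≈; tri>)
open import Relation.Binary.PropositionalEquality as ≡ using (_≡_; _≢_)

module Sums {c ℓ : Level} (R : CommutativeRing c ℓ) where
  open LinAlg R
  open import Algebra.Properties.Ring ring using (-0#≈0#; -‿+-comm)
  open import Algebra.Properties.Semiring.Sum semiring
    using (sum; sum-cong-≋; sum-cong-≗; ∑-distrib-+; ∑-comm; *-distribˡ-sum)
  open import Relation.Binary.Reasoning.Setoid setoid

  sumF≡sum : ∀ {n} (f : Fin n → Carrier) → sumF f ≡ sum f
  sumF≡sum {zero}  f = ≡.refl
  sumF≡sum {suc n} f = ≡.cong (f zero +_) (sumF≡sum (λ i → f (suc i)))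

  sumF-cong : ∀ {n} {f g : Fin n → Carrier} → (∀ i → f i ≈ g i) → sumF f ≈ sumF g
  sumF-cong {f = f} {g} f≈g rewrite sumF≡sum f | sumF≡sum g = sum-cong-≋ f≈g

  sumF-zero : ∀ {n} {f : Fin n → Carrier} → (∀ i → f i ≈ 0#) → sumF f ≈ 0#
  sumF-zero {zero}  f≈0 = refl
  sumF-zero {suc n} f≈0 =
    trans (+-cong (f≈0 zero) (sumF-zero (λ i → f≈0 (suc i)))) (+-identityˡ 0#)

  sumF-distrib-+ : ∀ {n} (f g : Fin n → Carrier) →
                   sumF (λ i → f i + g i) ≈ sumF f + sumF g
  sumF-distrib-+ f g
    rewrite sumF≡sum (λ i → f i + g i) | sumF≡sum f | sumF≡sum g = ∑-distrib-+ f g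

  *-distribˡ-sumF : ∀ {n} x (f : Fin n → Carrier) → x * sumF f ≈ sumF (λ i → x * f i)
  *-distribˡ-sumF x f
    rewrite sumF≡sum f | sumF≡sum (λ i → x * f i) = *-distribˡ-sum x f

  *-distribʳ-sumF : ∀ {n} x (f : Fin n → Carrier) → sumF f * x ≈ sumF (λ i → f i * x)
  *-distribʳ-sumF x f = begin
    sumF f * x              ≈⟨ *-comm _ x ⟩
    x * sumF f              ≈⟨ *-distribˡ-sumF x f ⟩
    sumF (λ i → x * f i)    ≈⟨ sumF-cong (λ i → *-comm x (f i)) ⟩
    sumF (λ i → f i * x)    ∎

  sumF-comm : ∀ {m n} (f : Fin m → Fin n → Carrier) →
              sumF (λ i → sumF (f i)) ≈ sumF (λ j → sumF (λ i → f i j))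
  sumF-comm f = begin
    sumF (λ i → sumF (f i))           ≡⟨ sumF≡sum (λ i → sumF (f i)) ⟩
    sum (λ i → sumF (f i))            ≡⟨ sum-cong-≗ (λ i → sumF≡sum (f i)) ⟩
    sum (λ i → sum (f i))             ≈⟨ ∑-comm f ⟩
    sum (λ j → sum (λ i → f i j))     ≡⟨ sum-cong-≗ (λ j → sumF≡sum (λ i → f i j)) ⟨
    sum (λ j → sumF (λ i → f i j))    ≡⟨ sumF≡sum (λ j → sumF (λ i → f i j)) ⟨
    sumF (λ j → sumF (λ i → f i j))   ∎

  sumF-distrib-neg : ∀ {n} (f : Fin n → Carrier) → sumF (λ i → - f i) ≈ - sumF f
  sumF-distrib-neg {zero}  f = sym -0#≈0#
  sumF-distrib-neg {suc n} f =
    trans (+-congˡ (sumF-distrib-neg (λ i → f (suc i)))) (-‿+-comm _ _)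

  sumF-distrib-sub : ∀ {n} (f g : Fin n → Carrier) →
                     sumF (λ i → f i - g i) ≈ sumF f - sumF g
  sumF-distrib-sub f g =
    trans (sumF-distrib-+ f (λ i → - g i)) (+-congˡ (sumF-distrib-neg g))

  sumF-const : ∀ n x → sumF {n} (λ _ → x) ≈ natR n * x
  sumF-const zero    x = sym (zeroˡ x)
  sumF-const (suc n) x =
    trans (+-cong (sym (*-identityˡ x)) (sumF-const n x)) (sym (distribʳ x 1# (natR n)))

  sumF-single : ∀ {n} (i₀ : Fin n) (f : Fin n → Carrier) →
                (∀ i → i ≢ i₀ → f i ≈ 0#) → sumF f ≈ f i₀
  sumF-single zero f f≈0 =
    trans (+-congˡ (sumF-zero (λ i → f≈0 (suc i) λ ()))) (+-identityʳ _)
  sumF-single (suc i₀) f f≈0 =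
    trans (+-cong (f≈0 zero λ ())
                  (sumF-single i₀ (λ i → f (suc i))
                     (λ i i≢i₀ → f≈0 (suc i) (λ eq → i≢i₀ (suc-injective eq)))))
          (+-identityˡ _)

  sumF-single-block : ∀ {n} {size : Fin n → ℕ} (j₀ : Fin n) (f : (j : Fin n) → Fin (size j) → Carrier) →
                      (∀ j → j ≢ j₀ → ∀ x → f j x ≈ 0#) →
                      sumF (λ j → sumF (f j)) ≈ sumF (f j₀)
  sumF-single-block j₀ f f≈0 = sumF-single j₀ (λ j → sumF (f j)) (λ j j≢j₀ → sumF-zero (f≈0 j j≢j₀))

  sumF-splitAt : ∀ m {n} (f : Fin (m ℕ.+ n) → Carrier) →
                 sumF f ≈ sumF (λ i → f (i ↑ˡ n)) + sumF (λ i → f (m ↑ʳ i))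
  sumF-splitAt zero    f = sym (+-identityˡ _)
  sumF-splitAt (suc m) f =
    trans (+-congˡ (sumF-splitAt m (λ i → f (suc i)))) (sym (+-assoc _ _ _))

module Matrices {c ℓ : Level} (R : CommutativeRing c ℓ) where
  open LinAlg R
  open Sums R
  open import Algebra.Properties.Ring ring using (-0#≈0#; -‿distribˡ-*)
  open import Relation.Binary.Reasoning.Setoid setoid

  idM-diag : ∀ {n} (i : Fin n) → idM i i ≈ 1#
  idM-diag i with i ≟ i
  ... | yes _  = refl
  ... | no i≢i = ⊥-elim (i≢i ≡.refl)

  idM-off : ∀ {n} {i j : Fin n} → i ≢ j → idM i j ≈ 0#
  idM-off {i = i} {j} i≢j with i ≟ j
  ... | yes i≡j = ⊥-elim (i≢j i≡j)
  ... | no _    = refl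

  idM-reindex : ∀ {m n} (e : Fin m → Fin n) → (∀ {i j} → e i ≡ e j → i ≡ j) →
                ∀ i j → idM (e i) (e j) ≈ idM i j
  idM-reindex e e-injective i j with i ≟ j
  ... | yes ≡.refl = idM-diag (e i)
  ... | no i≢j     = idM-off (λ eq → i≢j (e-injective eq))

  sumF-idMˡ : ∀ {n} (i : Fin n) (g : Fin n → Carrier) → sumF (λ l → idM i l * g l) ≈ g i
  sumF-idMˡ i g = begin
    sumF (λ l → idM i l * g l) ≈⟨ sumF-single i _ (λ l l≢i →
                                    trans (*-congʳ (idM-off (λ i≡l → l≢i (≡.sym i≡l)))) (zeroˡ _)) ⟩
    idM i i * g i              ≈⟨ trans (*-congʳ (idM-diag i)) (*-identityˡ _) ⟩
    g i                        ∎

  ⊗-assoc : ∀ {m n p q} (A : Matrix m n) (B : Matrix n p) (C : Matrix p q) →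
            ((A ⊗ B) ⊗ C) ≈M (A ⊗ (B ⊗ C))
  ⊗-assoc A B C i j = begin
    sumF (λ l → sumF (λ m → A i m * B m l) * C l j)
      ≈⟨ sumF-cong (λ l → *-distribʳ-sumF (C l j) (λ m → A i m * B m l)) ⟩
    sumF (λ l → sumF (λ m → (A i m * B m l) * C l j))
      ≈⟨ sumF-comm (λ l m → (A i m * B m l) * C l j) ⟩
    sumF (λ m → sumF (λ l → (A i m * B m l) * C l j))
      ≈⟨ sumF-cong (λ m → sumF-cong (λ l → *-assoc (A i m) (B m l) (C l j))) ⟩
    sumF (λ m → sumF (λ l → A i m * (B m l * C l j)))
      ≈⟨ sumF-cong (λ m → sym (*-distribˡ-sumF (A i m) (λ l → B m l * C l j))) ⟩
    sumF (λ m → A i m * sumF (λ l → B m l * C l j)) ∎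

  ⊗-congʳ : ∀ {m n p} {A A′ : Matrix m n} (B : Matrix n p) → A ≈M A′ → (A ⊗ B) ≈M (A′ ⊗ B)
  ⊗-congʳ B A≈A′ i j = sumF-cong (λ l → *-congʳ (A≈A′ i l))

  ⊗-identityˡ : ∀ {m n} (A : Matrix m n) → (idM ⊗ A) ≈M A
  ⊗-identityˡ A i j = sumF-idMˡ i (λ l → A l j)

  diagonalizer-eigencolumns : ∀ {n} (S T L : Matrix n n) → (S ⊗ T) ≈M idM → IsDiagonal ((T ⊗ L) ⊗ S) →
                 ∀ x y → (L ⊗ S) x y ≈ S x y * ((T ⊗ L) ⊗ S) y y
  diagonalizer-eigencolumns S T L S⊗T≈I diagonal x y = begin
    (L ⊗ S) x y                  ≈⟨ ⊗-congʳ S (⊗-identityˡ L) x y ⟨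
    ((idM ⊗ L) ⊗ S) x y          ≈⟨ ⊗-congʳ S (⊗-congʳ L S⊗T≈I) x y ⟨
    (((S ⊗ T) ⊗ L) ⊗ S) x y      ≈⟨ ⊗-congʳ S (⊗-assoc S T L) x y ⟩
    ((S ⊗ (T ⊗ L)) ⊗ S) x y      ≈⟨ ⊗-assoc S (T ⊗ L) S x y ⟩
    (S ⊗ ((T ⊗ L) ⊗ S)) x y      ≈⟨ sumF-single y _ (λ z z≢y → trans (*-congˡ (diagonal z y z≢y))
                                                                     (zeroʳ _)) ⟩
    S x y * ((T ⊗ L) ⊗ S) y y    ∎

  eigencolumns⇒isDiagonal : ∀ {m n} (T : Matrix n m) (L : Matrix m m) (B : Matrix m n)
                               (d : Fin n → Carrier) → (T ⊗ B) ≈M idM →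
                               (∀ i s → (L ⊗ B) i s ≈ B i s * d s) → IsDiagonal ((T ⊗ L) ⊗ B)
  eigencolumns⇒isDiagonal T L B d T⊗B≈I eigen r s r≢s = begin
    ((T ⊗ L) ⊗ B) r s                ≈⟨ ⊗-assoc T L B r s ⟩
    sumF (λ i → T r i * (L ⊗ B) i s) ≈⟨ sumF-cong (λ i → trans (*-congˡ (eigen i s))
                                                               (sym (*-assoc _ _ _))) ⟩
    sumF (λ i → T r i * B i s * d s) ≈⟨ *-distribʳ-sumF (d s) (λ i → T r i * B i s) ⟨
    (T ⊗ B) r s * d s                ≈⟨ *-congʳ (trans (T⊗B≈I r s) (idM-off r≢s)) ⟩
    0# * d s                         ≈⟨ zeroˡ _ ⟩
    0#                               ∎

  rowSum : ∀ {n} → Matrix n n → Fin n → Carrier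
  rowSum w i = sumF (w i)

  module _ {n} (w : Matrix n n) (loopless : ∀ i → w i i ≈ 0#) where

    laplacian≈degree-adjacency : ∀ i j → laplacian w i j ≈ idM i j * rowSum w i - w i j
    laplacian≈degree-adjacency i j with i ≟ j
    ... | yes ≡.refl = sym (trans (+-cong (*-identityˡ _) (trans (-‿cong (loopless i)) -0#≈0#))
                                 (+-identityʳ _))
    ... | no _       = sym (trans (+-congʳ (zeroˡ _)) (+-identityˡ _))

    laplacian-*-vector : ∀ i (g : Fin n → Carrier) →
                         sumF (λ l → laplacian w i l * g l) ≈
                         rowSum w i * g i - sumF (λ l → w i l * g l)
    laplacian-*-vector i g = begin
      sumF (λ l → laplacian w i l * g l)
        ≈⟨ sumF-cong (λ l → trans (*-congʳ (laplacian≈degree-adjacency i l))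
                                  (trans (distribʳ (g l) _ _)
                                         (+-congˡ (sym (-‿distribˡ-* _ _))))) ⟩
      sumF (λ l → idM i l * rowSum w i * g l - w i l * g l)
        ≈⟨ sumF-distrib-sub (λ l → idM i l * rowSum w i * g l) (λ l → w i l * g l) ⟩
      sumF (λ l → idM i l * rowSum w i * g l) - sumF (λ l → w i l * g l)
        ≈⟨ +-cong (trans (sumF-cong (λ l → *-assoc (idM i l) (rowSum w i) (g l)))
                         (sumF-idMˡ i (λ l → rowSum w i * g l))) refl ⟩
      rowSum w i * g i - sumF (λ l → w i l * g l) ∎

    laplacian-*-constant : ∀ i x → sumF (λ l → laplacian w i l * x) ≈ 0#
    laplacian-*-constant i x = begin
      sumF (λ l → laplacian w i l * x)         ≈⟨ laplacian-*-vector i (λ _ → x) ⟩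
      rowSum w i * x - sumF (λ l → w i l * x)  ≈⟨ +-congˡ (-‿cong (*-distribʳ-sumF x (w i))) ⟨
      rowSum w i * x - rowSum w i * x          ≈⟨ -‿inverseʳ _ ⟩
      0#                                       ∎

module Indicators {c ℓ : Level} (R : CommutativeRing c ℓ) where
  open LinAlg R
  open Sums R
  open import Algebra.Properties.Ring ring using (-0#≈0#)
  open import Data.Fin using (fromℕ<)
  open import Data.Fin.Properties using (toℕ-fromℕ<)
  open import Relation.Binary.Reasoning.Setoid setoid

  𝟙[_] : ∀ {p} {P : Set p} → Dec P → Carrier
  𝟙[ yes _ ] = 1#
  𝟙[ no  _ ] = 0#

  𝟙-yes : ∀ {p} {P : Set p} (d : Dec P) → P → 𝟙[ d ] ≈ 1#
  𝟙-yes (yes _) _  = refl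
  𝟙-yes (no ¬p) p = ⊥-elim (¬p p)

  𝟙-no : ∀ {p} {P : Set p} (d : Dec P) → ¬ P → 𝟙[ d ] ≈ 0#
  𝟙-no (yes p) ¬p = ⊥-elim (¬p p)
  𝟙-no (no _)  _  = refl

  𝟙-cong : ∀ {p q} {P : Set p} {Q : Set q} (d : Dec P) (d′ : Dec Q) →
           (P → Q) → (Q → P) → 𝟙[ d ] ≈ 𝟙[ d′ ]
  𝟙-cong (yes p) d′ to from = sym (𝟙-yes d′ (to p))
  𝟙-cong (no ¬p) d′ to from = sym (𝟙-no d′ (λ q → ¬p (from q)))

  idM≈𝟙 : ∀ {n} (i j : Fin n) → idM i j ≈ 𝟙[ toℕ i ≟ℕ toℕ j ]
  idM≈𝟙 i j with i ≟ j
  ... | yes ≡.refl = sym (𝟙-yes (toℕ i ≟ℕ toℕ i) ≡.refl)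
  ... | no i≢j     = sym (𝟙-no (toℕ i ≟ℕ toℕ j) (λ eq → i≢j (toℕ-injective eq)))

  𝟙[<suc]-𝟙[<] : ∀ m n → 𝟙[ m <? suc n ] - 𝟙[ m <? n ] ≈ 𝟙[ n ≟ℕ m ]
  𝟙[<suc]-𝟙[<] m n with ℕ.<-cmp m n
  ... | tri< m<n m≢n _ = begin
    𝟙[ m <? suc n ] - 𝟙[ m <? n ] ≈⟨ +-cong (𝟙-yes (m <? suc n) (ℕ.m≤n⇒m≤1+n m<n))
                                              (-‿cong (𝟙-yes (m <? n) m<n)) ⟩
    1# - 1#                       ≈⟨ -‿inverseʳ 1# ⟩
    0#                            ≈⟨ 𝟙-no (n ≟ℕ m) (λ n≡m → m≢n (≡.sym n≡m)) ⟨
    𝟙[ n ≟ℕ m ]                   ∎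
  ... | tri≈ _ ≡.refl _ = begin
    𝟙[ m <? suc m ] - 𝟙[ m <? m ] ≈⟨ +-cong (𝟙-yes (m <? suc m) ℕ.≤-refl)
                                              (-‿cong (𝟙-no (m <? m) (ℕ.<-irrefl ≡.refl))) ⟩
    1# - 0#                       ≈⟨ trans (+-congˡ -0#≈0#) (+-identityʳ 1#) ⟩
    1#                            ≈⟨ 𝟙-yes (m ≟ℕ m) ≡.refl ⟨
    𝟙[ m ≟ℕ m ]                   ∎
  ... | tri> _ m≢n n<m = begin
    𝟙[ m <? suc n ] - 𝟙[ m <? n ] ≈⟨ +-cong (𝟙-no (m <? suc n) (ℕ.≤⇒≯ n<m))
                                              (-‿cong (𝟙-no (m <? n) (ℕ.<⇒≯ n<m))) ⟩
    0# - 0#                       ≈⟨ -‿inverseʳ 0# ⟩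
    0#                            ≈⟨ 𝟙-no (n ≟ℕ m) (λ n≡m → m≢n (≡.sym n≡m)) ⟨
    𝟙[ n ≟ℕ m ]                   ∎

  sumℕ : ℕ → (ℕ → Carrier) → Carrier
  sumℕ n g = sumF {n} (λ i → g (toℕ i))

  sumℕ-cong : ∀ n {f g : ℕ → Carrier} → (∀ i → i ℕ.< n → f i ≈ g i) → sumℕ n f ≈ sumℕ n g
  sumℕ-cong n f≈g = sumF-cong (λ i → f≈g (toℕ i) (toℕ<n i))

  sumℕ-select : ∀ {n s} (g : ℕ → Carrier) → s ℕ.< n → sumℕ n (λ j → 𝟙[ j ≟ℕ s ] * g j) ≈ g s
  sumℕ-select {n} {s} g s<n = begin
    sumF {n} (λ i → 𝟙[ toℕ i ≟ℕ s ] * g (toℕ i))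
      ≈⟨ sumF-single (fromℕ< s<n) _ (λ i i≢s → trans
           (*-congʳ (𝟙-no (toℕ i ≟ℕ s) (λ eq →
              i≢s (toℕ-injective (≡.trans eq (≡.sym (toℕ-fromℕ< s<n)))))))
           (zeroˡ _)) ⟩
    𝟙[ toℕ (fromℕ< s<n) ≟ℕ s ] * g (toℕ (fromℕ< s<n))
      ≡⟨ ≡.cong (λ m → 𝟙[ m ≟ℕ s ] * g m) (toℕ-fromℕ< s<n) ⟩
    𝟙[ s ≟ℕ s ] * g s
      ≈⟨ trans (*-congʳ (𝟙-yes (s ≟ℕ s) ≡.refl)) (*-identityˡ _) ⟩
    g s ∎

  sumℕ-count : ∀ {n m} → m ℕ.≤ n → sumℕ n (λ j → 𝟙[ j <? m ]) ≈ natR m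
  sumℕ-count {n} {zero} _ = sumF-zero {n} (λ i → 𝟙-no (toℕ i <? 0) λ ())
  sumℕ-count {suc n} {suc m} (s≤s m≤n) =
    +-cong (𝟙-yes (0 <? suc m) (s≤s z≤n))
           (trans (sumℕ-cong n (λ j _ → 𝟙-cong (suc j <? suc m) (j <? m) ℕ.s<s⁻¹ s≤s))
                  (sumℕ-count m≤n))

module DifferenceMatrix {c ℓ : Level} (R : CommutativeRing c ℓ) where
  open LinAlg R
  open Sums R
  open Indicators R
  open import Algebra.Properties.Ring ring using (-0#≈0#; -‿+-comm; -‿distribˡ-*; ⁻¹-anti-homo‿-; xyx⁻¹≈y)
  open import Algebra.Properties.CommutativeSemigroup *-commutativeSemigroup using (x∙yz≈y∙xz)
  open import Relation.Binary.Reasoning.Setoid setoid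

  -- [1 v_1 … v_k] with the rows of each block X_j collapsed to a single row j
  C : ℕ → ℕ → Carrier
  C j zero    = 1#
  C j (suc s) = 𝟙[ j ≟ℕ s ] - 𝟙[ j ≟ℕ suc s ]

  sub-cancelʳ : ∀ p q x → (p - x) - (q - x) ≈ p - q
  sub-cancelʳ p q x = begin
    (p - x) - (q - x)   ≈⟨ +-congˡ (⁻¹-anti-homo‿- q x) ⟩
    (p - x) + (x - q)   ≈⟨ +-assoc p (- x) (x - q) ⟩
    p + (- x + (x - q)) ≈⟨ +-congˡ (sym (+-assoc (- x) x (- q))) ⟩
    p + ((- x + x) - q) ≈⟨ +-congˡ (+-congʳ (-‿inverseˡ x)) ⟩
    p + (0# - q)        ≈⟨ +-congˡ (+-identityˡ (- q)) ⟩
    p - q               ∎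

  shift-cancel : ∀ a p q y → a + ((p - (a + y)) - (q - y)) ≈ p - q
  shift-cancel a p q y = begin
    a + ((p - (a + y)) - (q - y))  ≈⟨ +-congˡ (+-congʳ (+-congˡ (-‿+-comm a y))) ⟨
    a + ((p + (- a - y)) - (q - y)) ≈⟨ +-congˡ (+-congʳ (+-assoc p (- a) (- y))) ⟨
    a + (((p - a) - y) - (q - y))  ≈⟨ +-congˡ (sub-cancelʳ (p - a) q y) ⟩
    a + ((p - a) - q)              ≈⟨ +-assoc a (p - a) (- q) ⟨
    (a + (p - a)) - q              ≈⟨ +-congʳ (trans (sym (+-assoc a p (- a))) (xyx⁻¹≈y a p)) ⟩
    p - q                          ∎

  sumℕ-*-C : ∀ {n s} (f : ℕ → Carrier) → suc s ℕ.< n →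
             sumℕ n (λ j → f j * C j (suc s)) ≈ f s - f (suc s)
  sumℕ-*-C {n} {s} f s+1<n = begin
    sumℕ n (λ j → f j * C j (suc s))
      ≈⟨ sumF-cong {n} (λ i → trans (*-comm _ _) (trans (distribʳ _ _ _)
                              (+-congˡ (sym (-‿distribˡ-* _ _))))) ⟩
    sumℕ n (λ j → 𝟙[ j ≟ℕ s ] * f j - 𝟙[ j ≟ℕ suc s ] * f j)
      ≈⟨ sumF-distrib-sub {n} (λ i → 𝟙[ toℕ i ≟ℕ s ] * f (toℕ i))
                              (λ i → 𝟙[ toℕ i ≟ℕ suc s ] * f (toℕ i)) ⟩
    sumℕ n (λ j → 𝟙[ j ≟ℕ s ] * f j) - sumℕ n (λ j → 𝟙[ j ≟ℕ suc s ] * f j)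
      ≈⟨ +-cong (sumℕ-select f (ℕ.<-trans (ℕ.n<1+n s) s+1<n))
                (-‿cong (sumℕ-select f s+1<n)) ⟩
    f s - f (suc s) ∎

  sumℕ-C-telescope : ∀ {k} j (F : ℕ → Carrier) → F 0 ≈ 0# → F (suc k) ≈ 0# → j ℕ.≤ k →
                     sumℕ k (λ s → C j (suc s) * F (suc s)) ≈ F (suc j) - F j
  sumℕ-C-telescope {k} j F F0≈0 Fk+1≈0 j≤k = begin
    sumℕ k (λ s → C j (suc s) * F (suc s))
      ≈⟨ sumF-cong {k} (λ i → trans (distribʳ _ _ _) (+-congˡ (sym (-‿distribˡ-* _ _)))) ⟩
    sumℕ k (λ s → 𝟙[ j ≟ℕ s ] * F (suc s) - 𝟙[ j ≟ℕ suc s ] * F (suc s))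
      ≈⟨ sumF-distrib-sub {k} (λ i → 𝟙[ j ≟ℕ toℕ i ] * F (suc (toℕ i)))
                              (λ i → 𝟙[ j ≟ℕ suc (toℕ i) ] * F (suc (toℕ i))) ⟩
    sumℕ k (λ s → 𝟙[ j ≟ℕ s ] * F (suc s)) - sumℕ k (λ s → 𝟙[ j ≟ℕ suc s ] * F (suc s))
      ≈⟨ +-cong (leaving j j≤k) (-‿cong (entering j j≤k)) ⟩
    F (suc j) - F j ∎
    where
    select : ∀ {n} j → j ℕ.< n → sumℕ n (λ s → 𝟙[ j ≟ℕ s ] * F (suc s)) ≈ F (suc j)
    select {n} j j<n =
      trans (sumℕ-cong n (λ s _ → *-congʳ {F (suc s)} (𝟙-cong (j ≟ℕ s) (s ≟ℕ j) ≡.sym ≡.sym)))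
            (sumℕ-select (λ s → F (suc s)) j<n)

    leaving : ∀ j → j ℕ.≤ k → sumℕ k (λ s → 𝟙[ j ≟ℕ s ] * F (suc s)) ≈ F (suc j)
    leaving j j≤k with j <? k
    ... | yes j<k = select j j<k
    ... | no  j≮k with ℕ.≤-antisym j≤k (ℕ.≮⇒≥ j≮k)
    ...   | ≡.refl = trans (sumF-zero {k} (λ i → trans (*-congʳ (𝟙-no (j ≟ℕ toℕ i)
                              (λ j≡i → j≮k (≡.subst (ℕ._< k) (≡.sym j≡i) (toℕ<n i))))) (zeroˡ _)))
                           (sym Fk+1≈0)

    entering : ∀ j → j ℕ.≤ k → sumℕ k (λ s → 𝟙[ j ≟ℕ suc s ] * F (suc s)) ≈ F j
    entering zero     _      = trans (sumF-zero {k} (λ i → trans (*-congʳ (𝟙-no (0 ≟ℕ suc (toℕ i)) λ ()))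
                                                                (zeroˡ _)))
                                     (sym F0≈0)
    entering (suc j₀) j₀<k = trans (sumℕ-cong k (λ s _ → *-congʳ {F (suc s)}
                                     (𝟙-cong (suc j₀ ≟ℕ suc s) (j₀ ≟ℕ s) ℕ.suc-injective (≡.cong suc))))
                                   (select j₀ j₀<k)

  C-vanishes : ∀ {j s} → j ≢ s → j ≢ suc s → C j (suc s) ≈ 0#
  C-vanishes {j} {s} j≢s j≢s+1 =
    trans (+-cong (𝟙-no (j ≟ℕ s) j≢s) (trans (-‿cong (𝟙-no (j ≟ℕ suc s) j≢s+1)) -0#≈0#))
          (+-identityʳ 0#)

  C-supports-disjoint : ∀ j {s s′} → suc s ℕ.< s′ → C j (suc s) * C j (suc s′) ≈ 0#
  C-supports-disjoint j {s} {s′} s+1<s′ with j ≟ℕ s | j ≟ℕ suc s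
  ... | yes ≡.refl | _ = trans (*-congˡ (C-vanishes {s} {s′}
      (λ { ≡.refl → ℕ.<-irrefl ≡.refl (ℕ.<-trans (ℕ.n<1+n s) s+1<s′) })
      (λ { ≡.refl → ℕ.<⇒≱ s+1<s′ (ℕ.m≤n⇒m≤1+n (ℕ.n≤1+n s′)) }))) (zeroʳ _)
  ... | no _ | yes ≡.refl = trans (*-congˡ (C-vanishes {suc s} {s′}
      (λ { ≡.refl → ℕ.<-irrefl ≡.refl s+1<s′ })
      (λ { ≡.refl → ℕ.<-asym s+1<s′ (ℕ.n<1+n s′) }))) (zeroʳ _)
  ... | no _ | no _ = trans (*-congʳ (trans (+-congˡ -0#≈0#) (+-identityʳ 0#))) (zeroˡ _)

  module Inverse (k : ℕ) (a : Carrier) (a*[1+k]≈1 : a * natR (suc k) ≈ 1#) where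

    G : ℕ → ℕ → Carrier
    G zero    j = a
    G (suc s) j = 𝟙[ j <? suc s ] - natR (suc s) * a

    [1+k]*a≈1 : natR (suc k) * a ≈ 1#
    [1+k]*a≈1 = trans (*-comm _ a) a*[1+k]≈1

    [1+n]*a≈a+n*a : ∀ n → natR (suc n) * a ≈ a + natR n * a
    [1+n]*a≈a+n*a n = trans (distribʳ a 1# (natR n)) (+-congʳ (*-identityˡ a))

    G⊗C : ∀ {t t′} → t ℕ.< suc k → t′ ℕ.< suc k →
          sumℕ (suc k) (λ j → G t j * C j t′) ≈ 𝟙[ t ≟ℕ t′ ]
    G⊗C {zero} {zero} _ _ = begin
      sumℕ (suc k) (λ _ → a * 1#) ≈⟨ sumF-cong {suc k} (λ _ → *-identityʳ a) ⟩
      sumℕ (suc k) (λ _ → a)      ≈⟨ sumF-const (suc k) a ⟩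
      natR (suc k) * a            ≈⟨ [1+k]*a≈1 ⟩
      1#                          ≈⟨ 𝟙-yes (0 ≟ℕ 0) ≡.refl ⟨
      𝟙[ 0 ≟ℕ 0 ]                 ∎
    G⊗C {zero} {suc s′} _ s′+1<1+k = begin
      sumℕ (suc k) (λ j → a * C j (suc s′)) ≈⟨ sumℕ-*-C (λ _ → a) s′+1<1+k ⟩
      a - a                                 ≈⟨ -‿inverseʳ a ⟩
      0#                                    ≈⟨ 𝟙-no (0 ≟ℕ suc s′) (λ ()) ⟨
      𝟙[ 0 ≟ℕ suc s′ ]                      ∎
    G⊗C {suc s} {zero} s+1<1+k _ = begin
      sumℕ (suc k) (λ j → (𝟙[ j <? suc s ] - natR (suc s) * a) * 1#)
        ≈⟨ sumF-cong {suc k} (λ i → *-identityʳ (G (suc s) (toℕ i))) ⟩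
      sumℕ (suc k) (λ j → 𝟙[ j <? suc s ] - natR (suc s) * a)
        ≈⟨ sumF-distrib-sub {suc k} (λ i → 𝟙[ toℕ i <? suc s ]) (λ _ → natR (suc s) * a) ⟩
      sumℕ (suc k) (λ j → 𝟙[ j <? suc s ]) - sumℕ (suc k) (λ _ → natR (suc s) * a)
        ≈⟨ +-cong (sumℕ-count (ℕ.<⇒≤ s+1<1+k)) (-‿cong (sumF-const (suc k) _)) ⟩
      natR (suc s) - natR (suc k) * (natR (suc s) * a)
        ≈⟨ +-congˡ (-‿cong (trans (x∙yz≈y∙xz _ _ a)
                                      (trans (*-congˡ [1+k]*a≈1) (*-identityʳ _)))) ⟩
      natR (suc s) - natR (suc s)
        ≈⟨ -‿inverseʳ _ ⟩
      0#
        ≈⟨ 𝟙-no (suc s ≟ℕ 0) (λ ()) ⟨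
      𝟙[ suc s ≟ℕ 0 ] ∎
    G⊗C {suc s} {suc s′} _ s′+1<1+k = begin
      sumℕ (suc k) (λ j → G (suc s) j * C j (suc s′))
        ≈⟨ sumℕ-*-C (G (suc s)) s′+1<1+k ⟩
      (𝟙[ s′ <? suc s ] - natR (suc s) * a) - (𝟙[ suc s′ <? suc s ] - natR (suc s) * a)
        ≈⟨ sub-cancelʳ _ _ _ ⟩
      𝟙[ s′ <? suc s ] - 𝟙[ suc s′ <? suc s ]
        ≈⟨ +-congˡ (-‿cong (𝟙-cong (suc s′ <? suc s) (s′ <? s) ℕ.s<s⁻¹ s≤s)) ⟩
      𝟙[ s′ <? suc s ] - 𝟙[ s′ <? s ]
        ≈⟨ 𝟙[<suc]-𝟙[<] s′ s ⟩
      𝟙[ s ≟ℕ s′ ]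
        ≈⟨ 𝟙-cong (s ≟ℕ s′) (suc s ≟ℕ suc s′) (≡.cong suc) ℕ.suc-injective ⟩
      𝟙[ suc s ≟ℕ suc s′ ] ∎

    C⊗G : ∀ {j j′} → j ℕ.< suc k → j′ ℕ.< suc k →
          sumℕ (suc k) (λ t → C j t * G t j′) ≈ 𝟙[ j ≟ℕ j′ ]
    C⊗G {j} {j′} (s≤s j≤k) j′<1+k = begin
      1# * a + sumℕ k (λ s → C j (suc s) * φ (suc s))
        ≈⟨ +-cong (*-identityˡ a) (sumℕ-C-telescope j φ φ0≈0 φ[1+k]≈0 j≤k) ⟩
      a + ((𝟙[ j′ <? suc j ] - natR (suc j) * a) - (𝟙[ j′ <? j ] - natR j * a))
        ≈⟨ +-congˡ (+-congʳ (+-congˡ (-‿cong ([1+n]*a≈a+n*a j)))) ⟩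
      a + ((𝟙[ j′ <? suc j ] - (a + natR j * a)) - (𝟙[ j′ <? j ] - natR j * a))
        ≈⟨ shift-cancel a _ _ (natR j * a) ⟩
      𝟙[ j′ <? suc j ] - 𝟙[ j′ <? j ]
        ≈⟨ 𝟙[<suc]-𝟙[<] j′ j ⟩
      𝟙[ j ≟ℕ j′ ] ∎
      where
      φ : ℕ → Carrier
      φ n = 𝟙[ j′ <? n ] - natR n * a

      φ0≈0 : φ 0 ≈ 0#
      φ0≈0 = trans (+-cong (𝟙-no (j′ <? 0) λ ()) (trans (-‿cong (zeroˡ a)) -0#≈0#)) (+-identityʳ 0#)

      φ[1+k]≈0 : φ (suc k) ≈ 0#
      φ[1+k]≈0 = trans (+-cong (𝟙-yes (j′ <? suc k) j′<1+k) (-‿cong [1+k]*a≈1)) (-‿inverseʳ 1#)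

module UnionIndexing {c ℓ : Level} (R : CommutativeRing c ℓ) {k : ℕ} (ms : Vec ℕ (suc k)) where
  open LinAlg R
  open Union ms
  open Sums R

  embV : ∀ {k′} (ms′ : Vec ℕ k′) (j : Fin k′) → Fin (suc (lookup ms′ j)) → Fin (totalV ms′)
  embV (m ∷ ms′) zero    x = x ↑ˡ totalV ms′
  embV (m ∷ ms′) (suc j) x = suc m ↑ʳ embV ms′ j x

  vtxV-embV : ∀ {k′} (ms′ : Vec ℕ k′) j x → vtxV ms′ (embV ms′ j x) ≡ (j , x)
  vtxV-embV (m ∷ ms′) zero    x rewrite splitAt-↑ˡ (suc m) x (totalV ms′) = ≡.refl
  vtxV-embV (m ∷ ms′) (suc j) x
    rewrite splitAt-↑ʳ (suc m) (totalV ms′) (embV ms′ j x) | vtxV-embV ms′ j x = ≡.refl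

  embV-surjective : ∀ {k′} (ms′ : Vec ℕ k′) (i : Fin (totalV ms′)) →
                    Σ (Fin k′) λ j → Σ (Fin (suc (lookup ms′ j))) λ x → embV ms′ j x ≡ i
  embV-surjective (m ∷ ms′) i with splitAt (suc m) i in eq
  ... | inj₁ x = zero , x , splitAt⁻¹-↑ˡ eq
  ... | inj₂ i′ with embV-surjective ms′ i′
  ...   | j , x , e = suc j , x , ≡.trans (≡.cong (suc m ↑ʳ_) e) (splitAt⁻¹-↑ʳ eq)

  sumF-embV : ∀ {k′} (ms′ : Vec ℕ k′) (f : Fin (totalV ms′) → Carrier) →
              sumF f ≈ sumF (λ j → sumF (λ x → f (embV ms′ j x)))
  sumF-embV []        f = refl
  sumF-embV (m ∷ ms′) f =
    trans (sumF-splitAt (suc m) f) (+-congˡ (sumF-embV ms′ (λ i → f (suc m ↑ʳ i))))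

  rembV : ∀ {k′} (ms′ : Vec ℕ k′) (j : Fin k′) → Fin (lookup ms′ j) → Fin (restV ms′)
  rembV (m ∷ ms′) zero    x = x ↑ˡ restV ms′
  rembV (m ∷ ms′) (suc j) x = m ↑ʳ rembV ms′ j x

  rcolV-rembV : ∀ {k′} (ms′ : Vec ℕ k′) j x → rcolV ms′ (rembV ms′ j x) ≡ (j , x)
  rcolV-rembV (m ∷ ms′) zero    x rewrite splitAt-↑ˡ m x (restV ms′) = ≡.refl
  rcolV-rembV (m ∷ ms′) (suc j) x
    rewrite splitAt-↑ʳ m (restV ms′) (rembV ms′ j x) | rcolV-rembV ms′ j x = ≡.refl

  rembV-surjective : ∀ {k′} (ms′ : Vec ℕ k′) (b : Fin (restV ms′)) →
                     Σ (Fin k′) λ j → Σ (Fin (lookup ms′ j)) λ x → rembV ms′ j x ≡ b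
  rembV-surjective (m ∷ ms′) b with splitAt m b in eq
  ... | inj₁ x = zero , x , splitAt⁻¹-↑ˡ eq
  ... | inj₂ b′ with rembV-surjective ms′ b′
  ...   | j , x , e = suc j , x , ≡.trans (≡.cong (m ↑ʳ_) e) (splitAt⁻¹-↑ʳ eq)

  sumF-rembV : ∀ {k′} (ms′ : Vec ℕ k′) (f : Fin (restV ms′) → Carrier) →
               sumF f ≈ sumF (λ j → sumF (λ x → f (rembV ms′ j x)))
  sumF-rembV []        f = refl
  sumF-rembV (m ∷ ms′) f =
    trans (sumF-splitAt m f) (+-congˡ (sumF-rembV ms′ (λ b → f (m ↑ʳ b))))

  totalV≡length+restV : ∀ {k′} (ms′ : Vec ℕ k′) → totalV ms′ ≡ k′ ℕ.+ restV ms′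
  totalV≡length+restV []                = ≡.refl
  totalV≡length+restV {suc k′} (m ∷ ms′) = ≡.cong suc (begin
    m ℕ.+ totalV ms′          ≡⟨ ≡.cong (m ℕ.+_) (totalV≡length+restV ms′) ⟩
    m ℕ.+ (k′ ℕ.+ restV ms′)  ≡⟨ x∙yz≈y∙xz m k′ (restV ms′) ⟩
    k′ ℕ.+ (m ℕ.+ restV ms′)  ∎)
    where
    open ≡.≡-Reasoning
    open import Algebra.Properties.CommutativeSemigroup ℕ.+-commutativeSemigroup using (x∙yz≈y∙xz)

  offsetV : ∀ {k′} → Vec ℕ k′ → Fin k′ → ℕ
  offsetV (m ∷ ms′) zero    = 0
  offsetV (m ∷ ms′) (suc j) = m ℕ.+ offsetV ms′ j

  toℕ-rembV : ∀ {k′} (ms′ : Vec ℕ k′) j c → toℕ (rembV ms′ j c) ≡ offsetV ms′ j ℕ.+ toℕ c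
  toℕ-rembV (m ∷ ms′) zero    c = toℕ-↑ˡ c (restV ms′)
  toℕ-rembV (m ∷ ms′) (suc j) c = ≡.trans (toℕ-↑ʳ m (rembV ms′ j c))
    (≡.trans (≡.cong (m ℕ.+_) (toℕ-rembV ms′ j c)) (≡.sym (ℕ.+-assoc m (offsetV ms′ j) (toℕ c))))

  emb : (j : Fin (suc k)) → Fin (size j) → Fin N
  emb = embV ms

  vtx-emb : ∀ j x → vtx (emb j x) ≡ (j , x)
  vtx-emb = vtxV-embV ms

  -- the columns 1_N, v_1, …, v_k, and the column of ⊕ S_j[1] holding column c+1 of S_j
  ucol : Fin (suc k) → Fin M
  ucol t = t ↑ˡ restV ms

  bcol : (j : Fin (suc k)) → Fin (lookup ms j) → Fin M
  bcol j c = suc k ↑ʳ rembV ms j c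

  decode : Fin M → Fin (suc k) ⊎ Σ (Fin (suc k)) (λ j → Fin (lookup ms j))
  decode col with splitAt (suc k) col
  ... | inj₁ t = inj₁ t
  ... | inj₂ b = inj₂ (rcolV ms b)

  decode-ucol : ∀ t → decode (ucol t) ≡ inj₁ t
  decode-ucol t rewrite splitAt-↑ˡ (suc k) t (restV ms) = ≡.refl

  decode-bcol : ∀ j c → decode (bcol j c) ≡ inj₂ (j , c)
  decode-bcol j c rewrite splitAt-↑ʳ (suc k) (restV ms) (rembV ms j c) | rcolV-rembV ms j c = ≡.refl

  data RowView : Fin N → Set where
    vertex : ∀ j x → RowView (emb j x)

  rowView : ∀ i → RowView i
  rowView i with embV-surjective ms i
  ... | j , x , e = ≡.subst RowView e (vertex j x)

  data ColView : Fin M → Set where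
    unionCol : ∀ t → ColView (ucol t)
    blockCol : ∀ j c → ColView (bcol j c)

  colView : ∀ col → ColView col
  colView col with splitAt (suc k) col in eq
  ... | inj₁ t = ≡.subst ColView (splitAt⁻¹-↑ˡ eq) (unionCol t)
  ... | inj₂ b with rembV-surjective ms b
  ...   | j , c , e = ≡.subst ColView (≡.trans (≡.cong (suc k ↑ʳ_) e) (splitAt⁻¹-↑ʳ eq)) (blockCol j c)

  sumF-rows : (f : Fin N → Carrier) → sumF f ≈ sumF (λ j → sumF (λ x → f (emb j x)))
  sumF-rows = sumF-embV ms

  sumF-cols : (f : Fin M → Carrier) →
              sumF f ≈ sumF (λ t → f (ucol t)) + sumF (λ j → sumF (λ c → f (bcol j c)))
  sumF-cols f = trans (sumF-splitAt (suc k) f) (+-congˡ (sumF-rembV ms (λ b → f (suc k ↑ʳ b))))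

  M≡N : M ≡ N
  M≡N = ≡.sym (totalV≡length+restV ms)

  toℕ-bcol : ∀ j c → toℕ (bcol j c) ≡ suc k ℕ.+ (offsetV ms j ℕ.+ toℕ c)
  toℕ-bcol j c = ≡.trans (toℕ-↑ʳ (suc k) (rembV ms j c)) (≡.cong (suc k ℕ.+_) (toℕ-rembV ms j c))

  bcol-gap : ∀ j c c′ → suc (toℕ (bcol j c)) ℕ.< toℕ (bcol j c′) → suc (toℕ c) ℕ.< toℕ c′
  bcol-gap j c c′ gap =
    ℕ.+-cancelˡ-< o (suc (toℕ c)) (toℕ c′) (≡.subst (ℕ._< o ℕ.+ toℕ c′) (≡.sym (ℕ.+-suc o (toℕ c)))
      (ℕ.+-cancelˡ-< (suc k) (suc (o ℕ.+ toℕ c)) (o ℕ.+ toℕ c′)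
        (≡.subst (ℕ._< suc k ℕ.+ (o ℕ.+ toℕ c′)) (≡.sym (ℕ.+-suc (suc k) (o ℕ.+ toℕ c)))
          (≡.subst₂ (λ u v → suc u ℕ.< v) (toℕ-bcol j c) (toℕ-bcol j c′) gap))))
    where o = offsetV ms j

  cong-image : ∀ {a b} {A : Set a} {B : Set b} (f : A → B) {x y u v} → f x ≡ u → f y ≡ v → x ≡ y → u ≡ v
  cong-image f fx≡u fy≡v ≡.refl = ≡.trans (≡.sym fx≡u) fy≡v

  emb-injective : ∀ {j x x′} → emb j x ≡ emb j x′ → x ≡ x′
  emb-injective {j} {x} {x′} eq with cong-image vtx (vtx-emb j x) (vtx-emb j x′) eq
  ... | ≡.refl = ≡.refl

  emb-≢ : ∀ {j j′ x x′} → j ≢ j′ → emb j x ≢ emb j′ x′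
  emb-≢ {j} {j′} {x} {x′} j≢j′ eq =
    j≢j′ (≡.cong proj₁ (cong-image vtx (vtx-emb j x) (vtx-emb j′ x′) eq))

  ucol-injective : ∀ {t t′} → ucol t ≡ ucol t′ → t ≡ t′
  ucol-injective {t} {t′} = ↑ˡ-injective (restV ms) t t′

  ucol≢bcol : ∀ {t j c} → ucol t ≢ bcol j c
  ucol≢bcol {t} {j} {c} eq with cong-image decode (decode-ucol t) (decode-bcol j c) eq
  ... | ()

  bcol-injective : ∀ {j c c′} → bcol j c ≡ bcol j c′ → c ≡ c′
  bcol-injective {j} {c} {c′} eq with cong-image decode (decode-bcol j c) (decode-bcol j c′) eq
  ... | ≡.refl = ≡.refl

  bcol-≢ : ∀ {j j′ c c′} → j ≢ j′ → bcol j c ≢ bcol j′ c′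
  bcol-≢ {j} {j′} {c} {c′} j≢j′ eq with cong-image decode (decode-bcol j c) (decode-bcol j′ c′) eq
  ... | ≡.refl = j≢j′ ≡.refl

module UnionEntries {c ℓ : Level} (R : CommutativeRing c ℓ) {k : ℕ} (ms : Vec ℕ (suc k)) where
  open LinAlg R
  open Union ms
  open Indicators R
  open DifferenceMatrix R
  open UnionIndexing R ms
  open import Algebra.Properties.Ring ring using (-0#≈0#)
  open import Relation.Binary.Reasoning.Setoid setoid

  ≡inject₁ : ∀ {n} {j : Fin (suc n)} {t : Fin n} → toℕ j ≡ toℕ t → j ≡ inject₁ t
  ≡inject₁ {t = t} eq = toℕ-injective (≡.trans eq (≡.sym (toℕ-inject₁ t)))

  vEntry≈C : ∀ t j → vEntry t j ≈ C (toℕ j) (suc (toℕ t))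
  vEntry≈C t j with j ≟ inject₁ t | j ≟ suc t
  ... | yes j≡t | _ = begin
    1#      ≈⟨ trans (+-congˡ -0#≈0#) (+-identityʳ 1#) ⟨
    1# - 0# ≈⟨ +-cong (𝟙-yes (toℕ j ≟ℕ toℕ t) j≡tℕ)
                      (-‿cong (𝟙-no (toℕ j ≟ℕ suc (toℕ t))
                                    (λ j≡t+1 → ℕ.1+n≢n (≡.trans (≡.sym j≡t+1) j≡tℕ)))) ⟨
    C (toℕ j) (suc (toℕ t)) ∎
    where j≡tℕ = ≡.trans (≡.cong toℕ j≡t) (toℕ-inject₁ t)
  ... | no j≢t | yes j≡t+1 = begin
    - 1#     ≈⟨ +-identityˡ (- 1#) ⟨
    0# - 1#  ≈⟨ +-cong (𝟙-no (toℕ j ≟ℕ toℕ t) (j≢t ∘ ≡inject₁))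
                       (-‿cong (𝟙-yes (toℕ j ≟ℕ suc (toℕ t)) (≡.cong toℕ j≡t+1))) ⟨
    C (toℕ j) (suc (toℕ t)) ∎
  ... | no j≢t | no j≢t+1 = begin
    0#       ≈⟨ -‿inverseʳ 0# ⟨
    0# - 0#  ≈⟨ +-cong (𝟙-no (toℕ j ≟ℕ toℕ t) (j≢t ∘ ≡inject₁))
                       (-‿cong (𝟙-no (toℕ j ≟ℕ suc (toℕ t)) (j≢t+1 ∘ toℕ-injective))) ⟨
    C (toℕ j) (suc (toℕ t)) ∎

  module _ (Ss : (j : Fin (suc k)) → Matrix (size j) (size j)) where

    bigMatrix-ucol : ∀ j x t → bigMatrix Ss (emb j x) (ucol t) ≈ C (toℕ j) (toℕ t)
    bigMatrix-ucol j x t rewrite vtx-emb j x | splitAt-↑ˡ (suc k) t (restV ms) with t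
    ... | zero  = refl
    ... | suc s = vEntry≈C s j

    bigMatrix-bcol-same : ∀ j x c → bigMatrix Ss (emb j x) (bcol j c) ≈ Ss j x (suc c)
    bigMatrix-bcol-same j x c
      rewrite vtx-emb j x | splitAt-↑ʳ (suc k) (restV ms) (rembV ms j c) | rcolV-rembV ms j c
      with j ≟ j
    ... | yes ≡.refl = refl
    ... | no j≢j     = ⊥-elim (j≢j ≡.refl)

    bigMatrix-bcol-≢ : ∀ {j j′} x c → j ≢ j′ → bigMatrix Ss (emb j x) (bcol j′ c) ≈ 0#
    bigMatrix-bcol-≢ {j} {j′} x c j≢j′
      rewrite vtx-emb j x | splitAt-↑ʳ (suc k) (restV ms) (rembV ms j′ c) | rcolV-rembV ms j′ c
      with j ≟ j′
    ... | yes j≡j′ = ⊥-elim (j≢j′ j≡j′)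
    ... | no _     = refl

  module _ (ws : (j : Fin (suc k)) → Matrix (size j) (size j)) where
    open Sums R
    open Matrices R

    unionW-same : ∀ j x x′ → unionW ws (emb j x) (emb j x′) ≈ ws j x x′
    unionW-same j x x′ rewrite vtx-emb j x | vtx-emb j x′ with j ≟ j
    ... | yes ≡.refl = refl
    ... | no j≢j     = ⊥-elim (j≢j ≡.refl)

    unionW-≢ : ∀ {j j′} x x′ → j ≢ j′ → unionW ws (emb j x) (emb j′ x′) ≈ 0#
    unionW-≢ {j} {j′} x x′ j≢j′ rewrite vtx-emb j x | vtx-emb j′ x′ with j ≟ j′
    ... | yes j≡j′ = ⊥-elim (j≢j′ j≡j′)
    ... | no _     = refl

    unionW-*-vector : ∀ j x (g : Fin N → Carrier) →
                      sumF (λ l → unionW ws (emb j x) l * g l) ≈ sumF (λ x′ → ws j x x′ * g (emb j x′))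
    unionW-*-vector j x g = begin
      sumF (λ l → unionW ws (emb j x) l * g l)
        ≈⟨ sumF-rows _ ⟩
      sumF (λ j′ → sumF (λ x′ → unionW ws (emb j x) (emb j′ x′) * g (emb j′ x′)))
        ≈⟨ sumF-single-block j (λ j′ x′ → unionW ws (emb j x) (emb j′ x′) * g (emb j′ x′))
             (λ j′ j′≢j x′ → trans (*-congʳ (unionW-≢ x x′ (λ j≡j′ → j′≢j (≡.sym j≡j′)))) (zeroˡ _)) ⟩
      sumF (λ x′ → unionW ws (emb j x) (emb j x′) * g (emb j x′))
        ≈⟨ sumF-cong (λ x′ → *-congʳ {g (emb j x′)} (unionW-same j x x′)) ⟩
      sumF (λ x′ → ws j x x′ * g (emb j x′)) ∎

    module _ (loopless : ∀ j x → ws j x x ≈ 0#) where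

      unionW-loopless : ∀ i → unionW ws i i ≈ 0#
      unionW-loopless i with rowView i
      ... | vertex j x = trans (unionW-same j x x) (loopless j x)

      rowSum-unionW : ∀ j x → rowSum (unionW ws) (emb j x) ≈ rowSum (ws j) x
      rowSum-unionW j x = begin
        sumF (λ l → unionW ws (emb j x) l)          ≈⟨ sumF-cong (λ l → *-identityʳ (unionW ws (emb j x) l)) ⟨
        sumF (λ l → unionW ws (emb j x) l * 1#)     ≈⟨ unionW-*-vector j x (λ _ → 1#) ⟩
        sumF (λ x′ → ws j x x′ * 1#)                ≈⟨ sumF-cong (λ x′ → *-identityʳ (ws j x x′)) ⟩
        sumF (λ x′ → ws j x x′)                     ∎

      laplacian-unionW-*-vector :
        ∀ j x (g : Fin N → Carrier) →
        sumF (λ l → laplacian (unionW ws) (emb j x) l * g l) ≈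
        sumF (λ x′ → laplacian (ws j) x x′ * g (emb j x′))
      laplacian-unionW-*-vector j x g = begin
        sumF (λ l → laplacian (unionW ws) (emb j x) l * g l)
          ≈⟨ laplacian-*-vector (unionW ws) unionW-loopless (emb j x) g ⟩
        rowSum (unionW ws) (emb j x) * g (emb j x) - sumF (λ l → unionW ws (emb j x) l * g l)
          ≈⟨ +-cong (*-congʳ (rowSum-unionW j x)) (-‿cong (unionW-*-vector j x g)) ⟩
        rowSum (ws j) x * g (emb j x) - sumF (λ x′ → ws j x x′ * g (emb j x′))
          ≈⟨ laplacian-*-vector (ws j) (loopless j) x (λ x′ → g (emb j x′)) ⟨
        sumF (λ x′ → laplacian (ws j) x x′ * g (emb j x′)) ∎

module UnionDiagonalization {c ℓ : Level} (R : CommutativeRing c ℓ) {k : ℕ} (ms : Vec ℕ (suc k))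
  where
  open LinAlg R
  open Union ms
  open Sums R
  open Matrices R
  open Indicators R
  open DifferenceMatrix R
  open UnionIndexing R ms
  open UnionEntries R ms
  open import Algebra.Properties.CommutativeSemigroup *-commutativeSemigroup using (xy∙z≈xz∙y)
  open import Relation.Binary.Reasoning.Setoid setoid

  module _ (a : Carrier) (a*[1+k]≈1 : a * natR (suc k) ≈ 1#)
           (ws Ss : (j : Fin (suc k)) → Matrix (size j) (size j))
           (graphs : ∀ j → IsWeightedGraph (ws j))
           (Ss-diagonalize : ∀ j → Diagonalizes (Ss j) (laplacian (ws j)))
           (Ss-col₀≈1 : ∀ j x → Ss j x zero ≈ 1#) where
    open Inverse k a a*[1+k]≈1

    Ts : (j : Fin (suc k)) → Matrix (size j) (size j)
    Ts j = proj₁ (Ss-diagonalize j)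

    Ts⊗Ss≈I : ∀ j → (Ts j ⊗ Ss j) ≈M idM
    Ts⊗Ss≈I j = proj₁ (proj₁ (proj₂ (Ss-diagonalize j)))

    Ss⊗Ts≈I : ∀ j → (Ss j ⊗ Ts j) ≈M idM
    Ss⊗Ts≈I j = proj₂ (proj₁ (proj₂ (Ss-diagonalize j)))

    D : (j : Fin (suc k)) → Matrix (size j) (size j)
    D j = (Ts j ⊗ laplacian (ws j)) ⊗ Ss j

    D-diagonal : ∀ j → IsDiagonal (D j)
    D-diagonal j = proj₂ (proj₂ (Ss-diagonalize j))

    B : Matrix N M
    B = bigMatrix Ss

    T : Matrix M N
    T col i with vtx i | decode col
    ... | j , x | inj₁ t        = G (toℕ t) (toℕ j) * Ts j zero x
    ... | j , x | inj₂ (j′ , c) with j′ ≟ j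
    ...   | yes ≡.refl = Ts j′ (suc c) x
    ...   | no  _      = 0#

    T-ucol : ∀ t j x → T (ucol t) (emb j x) ≡ G (toℕ t) (toℕ j) * Ts j zero x
    T-ucol t j x rewrite vtx-emb j x | decode-ucol t = ≡.refl

    T-bcol-same : ∀ j c x → T (bcol j c) (emb j x) ≈ Ts j (suc c) x
    T-bcol-same j c x rewrite vtx-emb j x | decode-bcol j c with j ≟ j
    ... | yes ≡.refl = refl
    ... | no j≢j     = ⊥-elim (j≢j ≡.refl)

    T-bcol-≢ : ∀ {j′ j} c x → j′ ≢ j → T (bcol j′ c) (emb j x) ≈ 0#
    T-bcol-≢ {j′} {j} c x j′≢j rewrite vtx-emb j x | decode-bcol j′ c with j′ ≟ j
    ... | yes j′≡j = ⊥-elim (j′≢j j′≡j)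
    ... | no _     = refl

    sumF-Ts-row : ∀ j r → sumF (Ts j r) ≈ idM r zero
    sumF-Ts-row j r = begin
      sumF (Ts j r)                          ≈⟨ sumF-cong (λ x → trans (*-congˡ (Ss-col₀≈1 j x))
                                                                        (*-identityʳ (Ts j r x))) ⟨
      sumF (λ x → Ts j r x * Ss j x zero)    ≈⟨ Ts⊗Ss≈I j r zero ⟩
      idM r zero                             ∎

    T⊗B-ucol-ucol : ∀ t t′ → (T ⊗ B) (ucol t) (ucol t′) ≈ idM (ucol t) (ucol t′)
    T⊗B-ucol-ucol t t′ = begin
      (T ⊗ B) (ucol t) (ucol t′)
        ≈⟨ sumF-rows (λ i → T (ucol t) i * B i (ucol t′)) ⟩
      sumF (λ j → sumF (λ x → T (ucol t) (emb j x) * B (emb j x) (ucol t′)))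
        ≈⟨ sumF-cong {suc k} (λ j → sumF-cong {size j} (λ x →
             *-cong (reflexive (T-ucol t j x)) (bigMatrix-ucol Ss j x t′))) ⟩
      sumF (λ j → sumF (λ x → G (toℕ t) (toℕ j) * Ts j zero x * C (toℕ j) (toℕ t′)))
        ≈⟨ sumF-cong {suc k} (λ j → block j (G (toℕ t) (toℕ j)) (C (toℕ j) (toℕ t′))) ⟩
      sumF {suc k} (λ j → G (toℕ t) (toℕ j) * C (toℕ j) (toℕ t′))
        ≈⟨ G⊗C (toℕ<n t) (toℕ<n t′) ⟩
      𝟙[ toℕ t ≟ℕ toℕ t′ ]
        ≈⟨ trans (idM-reindex ucol ucol-injective t t′) (idM≈𝟙 t t′) ⟨
      idM (ucol t) (ucol t′) ∎
      where
      block : ∀ j g y → sumF (λ x → g * Ts j zero x * y) ≈ g * y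
      block j g y = begin
        sumF (λ x → g * Ts j zero x * y)   ≈⟨ sumF-cong {size j} (λ x → xy∙z≈xz∙y g (Ts j zero x) y) ⟩
        sumF (λ x → g * y * Ts j zero x)   ≈⟨ *-distribˡ-sumF (g * y) (Ts j zero) ⟨
        g * y * sumF (Ts j zero)           ≈⟨ *-congˡ (trans (sumF-Ts-row j zero) (idM-diag {size j} zero)) ⟩
        g * y * 1#                         ≈⟨ *-identityʳ (g * y) ⟩
        g * y                              ∎

    T⊗B-ucol-bcol : ∀ t j c → (T ⊗ B) (ucol t) (bcol j c) ≈ idM (ucol t) (bcol j c)
    T⊗B-ucol-bcol t j c = begin
      (T ⊗ B) (ucol t) (bcol j c)
        ≈⟨ sumF-rows (λ i → T (ucol t) i * B i (bcol j c)) ⟩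
      sumF (λ j′ → sumF (λ x → T (ucol t) (emb j′ x) * B (emb j′ x) (bcol j c)))
        ≈⟨ sumF-single-block j (λ j′ x → T (ucol t) (emb j′ x) * B (emb j′ x) (bcol j c))
             (λ j′ j′≢j x → trans (*-congˡ (bigMatrix-bcol-≢ Ss x c j′≢j)) (zeroʳ _)) ⟩
      sumF (λ x → T (ucol t) (emb j x) * B (emb j x) (bcol j c))
        ≈⟨ sumF-cong {size j} (λ x → trans (*-cong (reflexive (T-ucol t j x)) (bigMatrix-bcol-same Ss j x c))
                                           (*-assoc (G (toℕ t) (toℕ j)) (Ts j zero x) (Ss j x (suc c)))) ⟩
      sumF (λ x → G (toℕ t) (toℕ j) * (Ts j zero x * Ss j x (suc c)))
        ≈⟨ *-distribˡ-sumF (G (toℕ t) (toℕ j)) (λ x → Ts j zero x * Ss j x (suc c)) ⟨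
      G (toℕ t) (toℕ j) * (Ts j ⊗ Ss j) zero (suc c)
        ≈⟨ *-congˡ (trans (Ts⊗Ss≈I j zero (suc c)) (idM-off {i = zero} {suc c} (λ ()))) ⟩
      G (toℕ t) (toℕ j) * 0#
        ≈⟨ zeroʳ _ ⟩
      0#
        ≈⟨ idM-off {i = ucol t} {bcol j c} ucol≢bcol ⟨
      idM (ucol t) (bcol j c) ∎

    T⊗B-bcol-ucol : ∀ j c t → (T ⊗ B) (bcol j c) (ucol t) ≈ idM (bcol j c) (ucol t)
    T⊗B-bcol-ucol j c t = begin
      (T ⊗ B) (bcol j c) (ucol t)
        ≈⟨ sumF-rows (λ i → T (bcol j c) i * B i (ucol t)) ⟩
      sumF (λ j′ → sumF (λ x → T (bcol j c) (emb j′ x) * B (emb j′ x) (ucol t)))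
        ≈⟨ sumF-single-block j (λ j′ x → T (bcol j c) (emb j′ x) * B (emb j′ x) (ucol t))
             (λ j′ j′≢j x → trans (*-congʳ (T-bcol-≢ c x (j′≢j ∘ ≡.sym))) (zeroˡ _)) ⟩
      sumF (λ x → T (bcol j c) (emb j x) * B (emb j x) (ucol t))
        ≈⟨ sumF-cong {size j} (λ x → *-cong (T-bcol-same j c x) (bigMatrix-ucol Ss j x t)) ⟩
      sumF (λ x → Ts j (suc c) x * C (toℕ j) (toℕ t))
        ≈⟨ *-distribʳ-sumF (C (toℕ j) (toℕ t)) (Ts j (suc c)) ⟨
      sumF (Ts j (suc c)) * C (toℕ j) (toℕ t)
        ≈⟨ *-congʳ (trans (sumF-Ts-row j (suc c)) (idM-off {i = suc c} {zero} (λ ()))) ⟩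
      0# * C (toℕ j) (toℕ t)
        ≈⟨ zeroˡ _ ⟩
      0#
        ≈⟨ idM-off {i = bcol j c} {ucol t} (λ eq → ucol≢bcol (≡.sym eq)) ⟨
      idM (bcol j c) (ucol t) ∎

    T⊗B-bcol-bcol : ∀ j c j′ c′ → (T ⊗ B) (bcol j c) (bcol j′ c′) ≈ idM (bcol j c) (bcol j′ c′)
    T⊗B-bcol-bcol j c j′ c′ = begin
      (T ⊗ B) (bcol j c) (bcol j′ c′)
        ≈⟨ sumF-rows (λ i → T (bcol j c) i * B i (bcol j′ c′)) ⟩
      sumF (λ j″ → sumF (λ x → T (bcol j c) (emb j″ x) * B (emb j″ x) (bcol j′ c′)))
        ≈⟨ sumF-single-block j (λ j″ x → T (bcol j c) (emb j″ x) * B (emb j″ x) (bcol j′ c′))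
             (λ j″ j″≢j x → trans (*-congʳ (T-bcol-≢ c x (j″≢j ∘ ≡.sym))) (zeroˡ _)) ⟩
      sumF (λ x → T (bcol j c) (emb j x) * B (emb j x) (bcol j′ c′))
        ≈⟨ sumF-cong {size j} (λ x → *-congʳ {B (emb j x) (bcol j′ c′)} (T-bcol-same j c x)) ⟩
      sumF (λ x → Ts j (suc c) x * B (emb j x) (bcol j′ c′))
        ≈⟨ same-block (j ≟ j′) ⟩
      idM (bcol j c) (bcol j′ c′) ∎
      where
      same-block : Dec (j ≡ j′) →
                   sumF (λ x → Ts j (suc c) x * B (emb j x) (bcol j′ c′)) ≈ idM (bcol j c) (bcol j′ c′)
      same-block (yes ≡.refl) = begin
        sumF (λ x → Ts j (suc c) x * B (emb j x) (bcol j c′))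
          ≈⟨ sumF-cong {size j} (λ x → *-congˡ {Ts j (suc c) x} (bigMatrix-bcol-same Ss j x c′)) ⟩
        (Ts j ⊗ Ss j) (suc c) (suc c′)
          ≈⟨ Ts⊗Ss≈I j (suc c) (suc c′) ⟩
        idM (suc c) (suc c′)
          ≈⟨ idM-reindex suc suc-injective c c′ ⟩
        idM c c′
          ≈⟨ idM-reindex (bcol j) bcol-injective c c′ ⟨
        idM (bcol j c) (bcol j c′) ∎
      same-block (no j≢j′) = begin
        sumF (λ x → Ts j (suc c) x * B (emb j x) (bcol j′ c′))
          ≈⟨ sumF-zero {size j} (λ x →
               trans (*-congˡ {Ts j (suc c) x} (bigMatrix-bcol-≢ Ss x c′ j≢j′)) (zeroʳ _)) ⟩
        0#
          ≈⟨ idM-off {i = bcol j c} {bcol j′ c′} (bcol-≢ j≢j′) ⟨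
        idM (bcol j c) (bcol j′ c′) ∎

    T⊗B≈I : (T ⊗ B) ≈M idM
    T⊗B≈I r s with colView r | colView s
    ... | unionCol t   | unionCol t′    = T⊗B-ucol-ucol t t′
    ... | unionCol t   | blockCol j c   = T⊗B-ucol-bcol t j c
    ... | blockCol j c | unionCol t     = T⊗B-bcol-ucol j c t
    ... | blockCol j c | blockCol j′ c′ = T⊗B-bcol-bcol j c j′ c′

    B⊗T-vertices : ∀ j x j′ x′ → (B ⊗ T) (emb j x) (emb j′ x′) ≈ idM (emb j x) (emb j′ x′)
    B⊗T-vertices j x j′ x′ = begin
      (B ⊗ T) (emb j x) (emb j′ x′)
        ≈⟨ sumF-cols (λ col → B (emb j x) col * T col (emb j′ x′)) ⟩
      sumF (λ t → B (emb j x) (ucol t) * T (ucol t) (emb j′ x′))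
        + sumF (λ j″ → sumF (λ c → B (emb j x) (bcol j″ c) * T (bcol j″ c) (emb j′ x′)))
        ≈⟨ +-cong unionCols blockCols ⟩
      𝟙[ toℕ j ≟ℕ toℕ j′ ] * Ts j′ zero x′ + sumF (λ c → Ss j x (suc c) * T (bcol j c) (emb j′ x′))
        ≈⟨ same-block (j ≟ j′) ⟩
      idM (emb j x) (emb j′ x′) ∎
      where
      unionCols : sumF (λ t → B (emb j x) (ucol t) * T (ucol t) (emb j′ x′)) ≈
                  𝟙[ toℕ j ≟ℕ toℕ j′ ] * Ts j′ zero x′
      unionCols = begin
        sumF (λ t → B (emb j x) (ucol t) * T (ucol t) (emb j′ x′))
          ≈⟨ sumF-cong {suc k} (λ t → trans (*-cong (bigMatrix-ucol Ss j x t) (reflexive (T-ucol t j′ x′)))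
                                            (sym (*-assoc _ _ (Ts j′ zero x′)))) ⟩
        sumF {suc k} (λ t → C (toℕ j) (toℕ t) * G (toℕ t) (toℕ j′) * Ts j′ zero x′)
          ≈⟨ *-distribʳ-sumF {suc k} (Ts j′ zero x′) (λ t → C (toℕ j) (toℕ t) * G (toℕ t) (toℕ j′))
           ⟨
        sumF {suc k} (λ t → C (toℕ j) (toℕ t) * G (toℕ t) (toℕ j′)) * Ts j′ zero x′
          ≈⟨ *-congʳ (C⊗G (toℕ<n j) (toℕ<n j′)) ⟩
        𝟙[ toℕ j ≟ℕ toℕ j′ ] * Ts j′ zero x′ ∎

      blockCols : sumF (λ j″ → sumF (λ c → B (emb j x) (bcol j″ c) * T (bcol j″ c) (emb j′ x′))) ≈
                  sumF (λ c → Ss j x (suc c) * T (bcol j c) (emb j′ x′))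
      blockCols = begin
        sumF (λ j″ → sumF (λ c → B (emb j x) (bcol j″ c) * T (bcol j″ c) (emb j′ x′)))
          ≈⟨ sumF-single-block j (λ j″ c → B (emb j x) (bcol j″ c) * T (bcol j″ c) (emb j′ x′))
               (λ j″ j″≢j c → trans (*-congʳ (bigMatrix-bcol-≢ Ss x c (j″≢j ∘ ≡.sym)))
                                    (zeroˡ _)) ⟩
        sumF (λ c → B (emb j x) (bcol j c) * T (bcol j c) (emb j′ x′))
          ≈⟨ sumF-cong (λ c → *-congʳ {T (bcol j c) (emb j′ x′)} (bigMatrix-bcol-same Ss j x c)) ⟩
        sumF (λ c → Ss j x (suc c) * T (bcol j c) (emb j′ x′)) ∎

      same-block : Dec (j ≡ j′) →
                   𝟙[ toℕ j ≟ℕ toℕ j′ ] * Ts j′ zero x′ + sumF (λ c → Ss j x (suc c) * T (bcol j c) (emb j′ x′))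
                   ≈ idM (emb j x) (emb j′ x′)
      same-block (yes ≡.refl) = begin
        𝟙[ toℕ j ≟ℕ toℕ j ] * Ts j zero x′ + sumF (λ c → Ss j x (suc c) * T (bcol j c) (emb j x′))
          ≈⟨ +-cong (*-congʳ (trans (𝟙-yes (toℕ j ≟ℕ toℕ j) ≡.refl) (sym (Ss-col₀≈1 j x))))
                    (sumF-cong (λ c → *-congˡ {Ss j x (suc c)} (T-bcol-same j c x′))) ⟩
        (Ss j ⊗ Ts j) x x′
          ≈⟨ Ss⊗Ts≈I j x x′ ⟩
        idM x x′
          ≈⟨ idM-reindex (emb j) emb-injective x x′ ⟨
        idM (emb j x) (emb j x′) ∎
      same-block (no j≢j′) = begin
        𝟙[ toℕ j ≟ℕ toℕ j′ ] * Ts j′ zero x′ + sumF (λ c → Ss j x (suc c) * T (bcol j c) (emb j′ x′))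
          ≈⟨ +-cong (trans (*-congʳ (𝟙-no (toℕ j ≟ℕ toℕ j′) (j≢j′ ∘ toℕ-injective))) (zeroˡ _))
                    (sumF-zero (λ c → trans (*-congˡ {Ss j x (suc c)} (T-bcol-≢ c x′ j≢j′)) (zeroʳ _))) ⟩
        0# + 0#
          ≈⟨ +-identityˡ 0# ⟩
        0#
          ≈⟨ idM-off {i = emb j x} {emb j′ x′} (emb-≢ j≢j′) ⟨
        idM (emb j x) (emb j′ x′) ∎

    B⊗T≈I : (B ⊗ T) ≈M idM
    B⊗T≈I i i′ with rowView i | rowView i′
    ... | vertex j x | vertex j′ x′ = B⊗T-vertices j x j′ x′

    eigenvalue : Fin M → Carrier
    eigenvalue col with decode col
    ... | inj₁ _       = 0#
    ... | inj₂ (j , c) = D j (suc c) (suc c)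

    eigenvalue-ucol : ∀ t → eigenvalue (ucol t) ≡ 0#
    eigenvalue-ucol t rewrite decode-ucol t = ≡.refl

    eigenvalue-bcol : ∀ j c → eigenvalue (bcol j c) ≡ D j (suc c) (suc c)
    eigenvalue-bcol j c rewrite decode-bcol j c = ≡.refl

    loopless : ∀ j x → ws j x x ≈ 0#
    loopless j = proj₂ (graphs j)

    laplacian⊗B-ucol : ∀ j x t →
                       (laplacian (unionW ws) ⊗ B) (emb j x) (ucol t) ≈ B (emb j x) (ucol t) * eigenvalue (ucol t)
    laplacian⊗B-ucol j x t = begin
      (laplacian (unionW ws) ⊗ B) (emb j x) (ucol t)
        ≈⟨ laplacian-unionW-*-vector ws loopless j x (λ i → B i (ucol t)) ⟩
      sumF (λ x′ → laplacian (ws j) x x′ * B (emb j x′) (ucol t))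
        ≈⟨ sumF-cong (λ x′ → *-congˡ {laplacian (ws j) x x′} (bigMatrix-ucol Ss j x′ t)) ⟩
      sumF (λ x′ → laplacian (ws j) x x′ * C (toℕ j) (toℕ t))
        ≈⟨ laplacian-*-constant (ws j) (loopless j) x (C (toℕ j) (toℕ t)) ⟩
      0#
        ≈⟨ trans (*-congˡ (reflexive (eigenvalue-ucol t))) (zeroʳ _) ⟨
      B (emb j x) (ucol t) * eigenvalue (ucol t) ∎

    laplacian⊗B-bcol : ∀ j x j′ c →
                       (laplacian (unionW ws) ⊗ B) (emb j x) (bcol j′ c) ≈
                       B (emb j x) (bcol j′ c) * eigenvalue (bcol j′ c)
    laplacian⊗B-bcol j x j′ c = begin
      (laplacian (unionW ws) ⊗ B) (emb j x) (bcol j′ c)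
        ≈⟨ laplacian-unionW-*-vector ws loopless j x (λ i → B i (bcol j′ c)) ⟩
      sumF (λ x′ → laplacian (ws j) x x′ * B (emb j x′) (bcol j′ c))
        ≈⟨ same-block (j ≟ j′) ⟩
      B (emb j x) (bcol j′ c) * eigenvalue (bcol j′ c) ∎
      where
      same-block : Dec (j ≡ j′) →
                   sumF (λ x′ → laplacian (ws j) x x′ * B (emb j x′) (bcol j′ c)) ≈
                   B (emb j x) (bcol j′ c) * eigenvalue (bcol j′ c)
      same-block (yes ≡.refl) = begin
        sumF (λ x′ → laplacian (ws j) x x′ * B (emb j x′) (bcol j c))
          ≈⟨ sumF-cong (λ x′ → *-congˡ {laplacian (ws j) x x′} (bigMatrix-bcol-same Ss j x′ c)) ⟩
        (laplacian (ws j) ⊗ Ss j) x (suc c)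
          ≈⟨ diagonalizer-eigencolumns (Ss j) (Ts j) (laplacian (ws j)) (Ss⊗Ts≈I j) (D-diagonal j)
                                       x (suc c) ⟩
        Ss j x (suc c) * D j (suc c) (suc c)
          ≈⟨ *-cong (bigMatrix-bcol-same Ss j x c) (reflexive (eigenvalue-bcol j c)) ⟨
        B (emb j x) (bcol j c) * eigenvalue (bcol j c) ∎
      same-block (no j≢j′) = begin
        sumF (λ x′ → laplacian (ws j) x x′ * B (emb j x′) (bcol j′ c))
          ≈⟨ sumF-zero (λ x′ → trans (*-congˡ {laplacian (ws j) x x′} (bigMatrix-bcol-≢ Ss x′ c j≢j′))
                                     (zeroʳ _)) ⟩
        0#
          ≈⟨ trans (*-congʳ (bigMatrix-bcol-≢ Ss x c j≢j′)) (zeroˡ _) ⟨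
        B (emb j x) (bcol j′ c) * eigenvalue (bcol j′ c) ∎

    laplacian⊗B-eigen : ∀ i col → (laplacian (unionW ws) ⊗ B) i col ≈ B i col * eigenvalue col
    laplacian⊗B-eigen i col with rowView i | colView col
    ... | vertex j x | unionCol t    = laplacian⊗B-ucol j x t
    ... | vertex j x | blockCol j′ c = laplacian⊗B-bcol j x j′ c

    bigMatrix-diagonalizes : Diagonalizes B (laplacian (unionW ws))
    bigMatrix-diagonalizes =
      T , (T⊗B≈I , B⊗T≈I) ,
      eigencolumns⇒isDiagonal T (laplacian (unionW ws)) B eigenvalue T⊗B≈I laplacian⊗B-eigen

module WeakHadamardMatrices {c ℓ : Level} (R : CommutativeRing c ℓ) where
  open LinAlg R
  open Sums R

  Ternary : Carrier → Set ℓ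
  Ternary x = (x ≈ - 1#) ⊎ (x ≈ 0#) ⊎ (x ≈ 1#)

  ternary-resp-≈ : ∀ {x y} → x ≈ y → Ternary y → Ternary x
  ternary-resp-≈ x≈y (inj₁ y≈-1)        = inj₁ (trans x≈y y≈-1)
  ternary-resp-≈ x≈y (inj₂ (inj₁ y≈0)) = inj₂ (inj₁ (trans x≈y y≈0))
  ternary-resp-≈ x≈y (inj₂ (inj₂ y≈1)) = inj₂ (inj₂ (trans x≈y y≈1))

  HasTernaryEntries : ∀ {m n} → Matrix m n → Set ℓ
  HasTernaryEntries P = ∀ i j → Ternary (P i j)

  HasTridiagonalGram : ∀ {m n} → Matrix m n → Set ℓ
  HasTridiagonalGram P = ∀ i j → (suc (toℕ i) ℕ.< toℕ j) ⊎ (suc (toℕ j) ℕ.< toℕ i) →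
                         (transpose P ⊗ P) i j ≈ 0#

  gram-sym : ∀ {m n} (P : Matrix m n) i j → (transpose P ⊗ P) i j ≈ (transpose P ⊗ P) j i
  gram-sym P i j = sumF-cong (λ l → *-comm (P l i) (P l j))

  hasTridiagonalGram : ∀ {m n} (P : Matrix m n) →
                       (∀ i j → suc (toℕ i) ℕ.< toℕ j → (transpose P ⊗ P) i j ≈ 0#) →
                       HasTridiagonalGram P
  hasTridiagonalGram P upper i j (inj₁ i≪j) = upper i j i≪j
  hasTridiagonalGram P upper i j (inj₂ j≪i) = trans (gram-sym P i j) (upper j i j≪i)

  weakHadamard-diagonalizer : ∀ {m n} → m ≡ n → (P : Matrix n m) (L : Matrix n n) →
                              HasTernaryEntries P → HasTridiagonalGram P → Diagonalizes P L →
                              Σ (Matrix n n) λ Q → IsWeakHadamard Q × Diagonalizes Q L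
  weakHadamard-diagonalizer ≡.refl P L ternary tridiagonal diagonalizes =
    P , (ternary , tridiagonal) , diagonalizes

module UnionWeakHadamard {c ℓ : Level} (R : CommutativeRing c ℓ) {k : ℕ} (ms : Vec ℕ (suc k)) where
  open LinAlg R
  open Union ms
  open Sums R
  open Indicators R
  open DifferenceMatrix R
  open UnionIndexing R ms
  open UnionEntries R ms
  open WeakHadamardMatrices R
  open import Relation.Binary.Reasoning.Setoid setoid

  SizeCondition : Set
  SizeCondition = k ≡ 1 ⊎ (∀ i j → lookup ms i ≡ lookup ms j)

  vEntry-ternary : ∀ t j → Ternary (vEntry t j)
  vEntry-ternary t j with j ≟ inject₁ t | j ≟ suc t
  ... | yes _ | _     = inj₂ (inj₂ refl)
  ... | no _  | yes _ = inj₁ refl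
  ... | no _  | no _  = inj₂ (inj₁ refl)

  module _ (Ss : (j : Fin (suc k)) → Matrix (size j) (size j)) where

    Gram : Matrix M M
    Gram = transpose (bigMatrix Ss) ⊗ bigMatrix Ss

    gram-blocks : ∀ r s → Gram r s ≈
                  sumF (λ j → sumF (λ x → bigMatrix Ss (emb j x) r * bigMatrix Ss (emb j x) s))
    gram-blocks r s = sumF-rows (λ i → bigMatrix Ss i r * bigMatrix Ss i s)

    bigMatrix-ternary : (∀ j → IsWeakHadamard (Ss j)) → HasTernaryEntries (bigMatrix Ss)
    bigMatrix-ternary Ss-weakHadamard i col with rowView i | colView col
    ... | vertex j x | unionCol zero    = ternary-resp-≈ (bigMatrix-ucol Ss j x zero) (inj₂ (inj₂ refl))
    ... | vertex j x | unionCol (suc t) =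
      ternary-resp-≈ (trans (bigMatrix-ucol Ss j x (suc t)) (sym (vEntry≈C t j))) (vEntry-ternary t j)
    ... | vertex j x | blockCol j′ c with j ≟ j′
    ...   | yes ≡.refl = ternary-resp-≈ (bigMatrix-bcol-same Ss j x c) (proj₁ (Ss-weakHadamard j) x (suc c))
    ...   | no j≢j′    = inj₂ (inj₁ (bigMatrix-bcol-≢ Ss x c j≢j′))

    gram-ucol-ucol : SizeCondition →
                     ∀ t t′ → suc (toℕ t) ℕ.< toℕ t′ → Gram (ucol t) (ucol t′) ≈ 0#
    gram-ucol-ucol balanced t t′ gap = begin
      Gram (ucol t) (ucol t′)
        ≈⟨ gram-blocks (ucol t) (ucol t′) ⟩
      sumF (λ j → sumF (λ x → bigMatrix Ss (emb j x) (ucol t) * bigMatrix Ss (emb j x) (ucol t′)))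
        ≈⟨ sumF-cong {suc k} (λ j → sumF-cong {size j} (λ x →
             *-cong (bigMatrix-ucol Ss j x t) (bigMatrix-ucol Ss j x t′))) ⟩
      sumF (λ j → sumF (λ (x : Fin (size j)) → C (toℕ j) (toℕ t) * C (toℕ j) (toℕ t′)))
        ≈⟨ columns balanced t t′ gap ⟩
      0# ∎
      where
      columns : SizeCondition → ∀ t t′ → suc (toℕ t) ℕ.< toℕ t′ →
                sumF (λ j → sumF (λ (x : Fin (size j)) → C (toℕ j) (toℕ t) * C (toℕ j) (toℕ t′))) ≈ 0#
      columns _ (suc s) (suc s′) gap =
        sumF-zero {suc k} (λ j → sumF-zero {size j} (λ _ → C-supports-disjoint (toℕ j) (ℕ.s<s⁻¹ gap)))
      columns (inj₁ k≡1) zero (suc s′) gap =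
        ⊥-elim (ℕ.<-irrefl ≡.refl
          (ℕ.≤-<-trans (ℕ.s<s⁻¹ gap) (≡.subst (toℕ s′ ℕ.<_) k≡1 (toℕ<n s′))))
      columns (inj₂ equalSizes) zero (suc s′) gap = begin
        sumF (λ j → sumF (λ (x : Fin (size j)) → 1# * C (toℕ j) (suc (toℕ s′))))
          ≈⟨ sumF-cong {suc k} (λ j → trans (sumF-const (size j) (1# * C (toℕ j) (suc (toℕ s′))))
                                            (*-cong (reflexive (≡.cong (λ m → natR (suc m)) (equalSizes j zero)))
                                                    (*-identityˡ _))) ⟩
        sumℕ (suc k) (λ j → natR (size zero) * C j (suc (toℕ s′)))
          ≈⟨ sumℕ-*-C (λ _ → natR (size zero)) (s≤s (toℕ<n s′)) ⟩
        natR (size zero) - natR (size zero)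
          ≈⟨ -‿inverseʳ _ ⟩
        0# ∎

    gram-ucol-bcol : (∀ j c → sumF (λ x → 1# * Ss j x (suc c)) ≈ 0#) →
                     ∀ t j c → Gram (ucol t) (bcol j c) ≈ 0#
    gram-ucol-bcol orthogonal t j c = begin
      Gram (ucol t) (bcol j c)
        ≈⟨ gram-blocks (ucol t) (bcol j c) ⟩
      sumF (λ j′ → sumF (λ x → bigMatrix Ss (emb j′ x) (ucol t) * bigMatrix Ss (emb j′ x) (bcol j c)))
        ≈⟨ sumF-single-block j (λ j′ x → bigMatrix Ss (emb j′ x) (ucol t) * bigMatrix Ss (emb j′ x) (bcol j c))
             (λ j′ j′≢j x → trans (*-congˡ (bigMatrix-bcol-≢ Ss x c j′≢j)) (zeroʳ _)) ⟩
      sumF (λ x → bigMatrix Ss (emb j x) (ucol t) * bigMatrix Ss (emb j x) (bcol j c))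
        ≈⟨ sumF-cong {size j} (λ x → *-cong (bigMatrix-ucol Ss j x t)
                                             (trans (bigMatrix-bcol-same Ss j x c) (sym (*-identityˡ _)))) ⟩
      sumF (λ x → C (toℕ j) (toℕ t) * (1# * Ss j x (suc c)))
        ≈⟨ *-distribˡ-sumF (C (toℕ j) (toℕ t)) (λ x → 1# * Ss j x (suc c)) ⟨
      C (toℕ j) (toℕ t) * sumF (λ x → 1# * Ss j x (suc c))
        ≈⟨ *-congˡ (orthogonal j c) ⟩
      C (toℕ j) (toℕ t) * 0#
        ≈⟨ zeroʳ _ ⟩
      0# ∎

    gram-bcol-bcol : (∀ j → IsWeakHadamard (Ss j)) →
                     ∀ j c j′ c′ → suc (toℕ (bcol j c)) ℕ.< toℕ (bcol j′ c′) →
                     Gram (bcol j c) (bcol j′ c′) ≈ 0#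
    gram-bcol-bcol Ss-weakHadamard j c j′ c′ gap = begin
      Gram (bcol j c) (bcol j′ c′)
        ≈⟨ gram-blocks (bcol j c) (bcol j′ c′) ⟩
      sumF (λ j″ → sumF (λ x → bigMatrix Ss (emb j″ x) (bcol j c) * bigMatrix Ss (emb j″ x) (bcol j′ c′)))
        ≈⟨ sumF-single-block j
             (λ j″ x → bigMatrix Ss (emb j″ x) (bcol j c) * bigMatrix Ss (emb j″ x) (bcol j′ c′))
             (λ j″ j″≢j x → trans (*-congʳ (bigMatrix-bcol-≢ Ss x c j″≢j)) (zeroˡ _)) ⟩
      sumF (λ x → bigMatrix Ss (emb j x) (bcol j c) * bigMatrix Ss (emb j x) (bcol j′ c′))
        ≈⟨ same-block (j ≟ j′) gap ⟩
      0# ∎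
      where
      same-block : Dec (j ≡ j′) → suc (toℕ (bcol j c)) ℕ.< toℕ (bcol j′ c′) →
                   sumF (λ x → bigMatrix Ss (emb j x) (bcol j c) * bigMatrix Ss (emb j x) (bcol j′ c′)) ≈ 0#
      same-block (yes ≡.refl) gap = begin
        sumF (λ x → bigMatrix Ss (emb j x) (bcol j c) * bigMatrix Ss (emb j x) (bcol j c′))
          ≈⟨ sumF-cong {size j} (λ x → *-cong (bigMatrix-bcol-same Ss j x c) (bigMatrix-bcol-same Ss j x c′)) ⟩
        (transpose (Ss j) ⊗ Ss j) (suc c) (suc c′)
          ≈⟨ proj₂ (Ss-weakHadamard j) (suc c) (suc c′) (inj₁ (s≤s (bcol-gap j c c′ gap))) ⟩
        0# ∎
      same-block (no j≢j′) _ =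
        sumF-zero (λ x → trans (*-congˡ {bigMatrix Ss (emb j x) (bcol j c)} (bigMatrix-bcol-≢ Ss x c′ j≢j′))
                               (zeroʳ _))

    bigMatrix-tridiagonalGram : (∀ j c → sumF (λ x → 1# * Ss j x (suc c)) ≈ 0#) →
                                (∀ j → IsWeakHadamard (Ss j)) →
                                SizeCondition → HasTridiagonalGram (bigMatrix Ss)
    bigMatrix-tridiagonalGram orthogonal Ss-weakHadamard balanced = hasTridiagonalGram (bigMatrix Ss) upper
      where
      upper : ∀ r s → suc (toℕ r) ℕ.< toℕ s → Gram r s ≈ 0#
      upper r s gap with colView r | colView s
      ... | unionCol t   | unionCol t′    =
        gram-ucol-ucol balanced t t′
          (≡.subst₂ (λ u v → suc u ℕ.< v) (toℕ-↑ˡ t (restV ms)) (toℕ-↑ˡ t′ (restV ms)) gap)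
      ... | unionCol t   | blockCol j c   = gram-ucol-bcol orthogonal t j c
      ... | blockCol j c | unionCol t     =
        trans (gram-sym (bigMatrix Ss) (bcol j c) (ucol t)) (gram-ucol-bcol orthogonal t j c)
      ... | blockCol j c | blockCol j′ c′ = gram-bcol-bcol Ss-weakHadamard j c j′ c′ gap

proposition3p4 : {c ℓ : Level} (R : CommutativeRing c ℓ) →
    let open LinAlg R in
    -- R is a ℚ-algebra (every positive integer is invertible), as ℝ is
    (∀ m → Σ Carrier (λ y → (y * natR (suc m)) ≈ 1#)) →
    -- k+1 graphs X_0,…,X_k with n_j = suc (ms_j) vertices
    (k : ℕ) (ms : Vec ℕ (suc k)) →
    let open Union ms in
    (ws : (j : Fin (suc k)) → Matrix (size j) (size j)) →
    (Ss : (j : Fin (suc k)) → Matrix (size j) (size j)) →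
    (∀ j → IsWeightedGraph (ws j)) →
    (∀ j → Diagonalizes (Ss j) (laplacian (ws j))) →
    (∀ j x → Ss j x zero ≈ 1#) →
    (∀ j c → sumF (λ x → 1# * Ss j x (suc c)) ≈ 0#) →
    Diagonalizes (bigMatrix Ss) (laplacian (unionW ws)) ×
    ((∀ j → IsWeakHadamard (Ss j)) →
     (k ≡ 1 ⊎ (∀ i j → lookup ms i ≡ lookup ms j)) →
     WHD (unionW ws))
proposition3p4 R invertible k ms ws Ss graphs Ss-diagonalize Ss-col₀≈1 orthogonal =
  diagonalizes , λ Ss-weakHadamard balanced →
    weakHadamard-diagonalizer M≡N (bigMatrix Ss) (laplacian (unionW ws))
      (bigMatrix-ternary Ss Ss-weakHadamard)
      (bigMatrix-tridiagonalGram Ss orthogonal Ss-weakHadamard balanced)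
      diagonalizes
  where
  open LinAlg R
  open Union ms
  open UnionIndexing R ms using (M≡N)
  open UnionDiagonalization R ms using (bigMatrix-diagonalizes)
  open UnionWeakHadamard R ms using (bigMatrix-ternary; bigMatrix-tridiagonalGram)
  open WeakHadamardMatrices R using (weakHadamard-diagonalizer)

  diagonalizes : Diagonalizes (bigMatrix Ss) (laplacian (unionW ws))
  diagonalizes = bigMatrix-diagonalizes (proj₁ (invertible k)) (proj₂ (invertible k))
                                        ws Ss graphs Ss-diagonalize Ss-col₀≈1
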